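{- Let $d\ge2$ and $1\le k\le d-1$. If $A\subseteq\mathbb F_q^d$ is an arbitrary nonempty set and $B\subseteq\mathbb F_q^d$ is a nonempty subset of a $k$-coordinatable plane, then $$|\Delta(A,B)|\ge\frac12\min\left\{q,\ \frac{|A||B|}{2q^{d-1}}\right\}.$$
   Context: $q$ is a power of an odd prime. $\|x\|=\sum_{i=1}^dx_i^2$, $\Delta(A,B)=\{\|x-y\|:x\in A,y\in B\}$. The $k$-dimensional coordinate plane for indices $\{i_1,\dots,i_k\}$ is $\{x\in\mathbb F_q^d: x_j=0 \text{ for } j\notin\{i_1,\dots,i_k\}\}$. A rotation is $x\mapsto Rx$ with $R^\top R=I$, $\det R=1$ over $\mathbb F_q$; a translation is $x\mapsto x+v$. A $k$-dimensional affine subspace is a $k$-coordinatable plane if a rotation and a translation map it onto a $k$-dimensional coordinate plane. -}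

module Defs where

open import Data.Nat as ℕ using (ℕ; zero; suc; _∸_; _^_)
open import Data.Nat.Primality using (Prime)
open import Data.Nat.Divisibility using (_∣_)
open import Data.Bool using (Bool; true; false; _∧_; if_then_else_)
open import Data.Fin using (Fin; zero; suc; toℕ; punchIn)
open import Data.Fin.Subset using (Subset; _∈_; _∉_; ∣_∣)
open import Data.List using (List; []; _∷_; map; concatMap; filter; length; allFin)
open import Data.Bool.ListAction using (any)
open import Data.Product using (Σ; ∃; _×_; _,_)
open import Data.Integer using (+_)
open import Data.Rational using (ℚ; 0ℚ; _/_)
open import Relation.Nullary using (¬_; Dec; yes; no)
open import Relation.Nullary.Decidable using (⌊_⌋)
open import Relation.Binary.PropositionalEquality using (_≡_)
open import Relation.Binary.Definitions using (DecidableEquality)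
open import Algebra.Structures using (IsCommutativeRing)
open import Function.Bundles using (_↔_; Inverse)

OddPrimePower : ℕ → Set
OddPrimePower q = Σ ℕ λ p → Σ ℕ λ n → Prime p × ¬ (2 ∣ p) × 1 ℕ.≤ n × q ≡ p ^ n

record FiniteField (q : ℕ) : Set₁ where
  infixl 6 _+_
  infixl 7 _*_
  field
    F   : Set
    _+_ : F → F → F
    _*_ : F → F → F
    -_  : F → F
    0#  : F
    1#  : F
    isCommutativeRing : IsCommutativeRing _≡_ _+_ _*_ -_ 0# 1#
    0≢1 : ¬ (0# ≡ 1#)
    inverse : ∀ x → ¬ (x ≡ 0#) → ∃ λ y → x * y ≡ 1#
    _≟_ : DecidableEquality F
    enumeration : Fin q ↔ F

-- n / m as a rational number (m is always nonzero where used; 0 otherwise)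
frac : ℕ → ℕ → ℚ
frac n zero = 0ℚ
frac n (suc m) = (+ n) / suc m

module FF {q : ℕ} (𝔽 : FiniteField q) where
  open FiniteField 𝔽

  Point : ℕ → Set
  Point d = Fin d → F

  Matrix : ℕ → Set
  Matrix d = Fin d → Fin d → F

  ∑ : ∀ n → (Fin n → F) → F
  ∑ zero f = 0#
  ∑ (suc n) f = f zero + ∑ n (λ i → f (suc i))

  _-ᵥ_ : ∀ {d} → Point d → Point d → Point d
  (x -ᵥ y) i = x i + (- y i)

  _+ᵥ_ : ∀ {d} → Point d → Point d → Point d
  (x +ᵥ y) i = x i + y i

  ‖_‖ : ∀ {d} → Point d → F
  ‖_‖ {d} x = ∑ d (λ i → x i * x i)

  _·_ : ∀ {d} → Matrix d → Point d → Point d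
  _·_ {d} R x i = ∑ d (λ j → R i j * x j)

  neg^ : ℕ → F → F
  neg^ zero x = x
  neg^ (suc n) x = - (neg^ n x)

  det : ∀ n → Matrix n → F
  det zero M = 1#
  det (suc n) M = ∑ (suc n) (λ i → neg^ (toℕ i) (M i zero * det n (λ r c → M (punchIn i r) (suc c))))

  δ : ∀ {d} → Fin d → Fin d → F
  δ i j with i Data.Fin.≟ j
  ... | yes _ = 1#
  ... | no _ = 0#

  IsRotation : ∀ d → Matrix d → Set
  IsRotation d R = (∀ i j → ∑ d (λ k → R k i * R k j) ≡ δ i j) × det d R ≡ 1#

  CoordinatePlane : ∀ {d} → Subset d → Point d → Set
  CoordinatePlane I y = ∀ j → j ∉ I → y j ≡ 0#

  IsCoordinatablePlane : ∀ d (k : ℕ) → (Point d → Set) → Set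
  IsCoordinatablePlane d k S =
    Σ (Matrix d) λ R → Σ (Point d) λ v → Σ (Subset d) λ I →
      IsRotation d R × ∣ I ∣ ≡ k ×
      (∀ x → S x → CoordinatePlane I ((R · x) +ᵥ v)) ×
      (∀ y → CoordinatePlane I y → Σ (Point d) λ x → S x × (∀ i → ((R · x) +ᵥ v) i ≡ y i))

  elems : List F
  elems = map (Inverse.to enumeration) (allFin q)

  cons : ∀ {d} → F → Point d → Point (suc d)
  cons a x zero = a
  cons a x (suc i) = x i

  allPoints : ∀ d → List (Point d)
  allPoints zero = (λ ()) ∷ []
  allPoints (suc d) = concatMap (λ a → map (cons a) (allPoints d)) elems

  PSet : ℕ → Set
  PSet d = Point d → Bool

  card : ∀ {d} → PSet d → ℕ
  card {d} A = length (filter (λ x → A x Data.Bool.≟ true) (allPoints d))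

  inΔ : ∀ {d} → PSet d → PSet d → F → Bool
  inΔ {d} A B t = any (λ x → A x ∧ any (λ y → B y ∧ ⌊ ‖ x -ᵥ y ‖ ≟ t ⌋) (allPoints d)) (allPoints d)

  cardΔ : ∀ {d} → PSet d → PSet d → ℕ
  cardΔ A B = length (filter (λ t → inΔ A B t Data.Bool.≟ true) elems)

toℚ : ℕ → ℚ
toℚ n = (+ n) / 1

{-# OPTIONS --safe #-}

-- Let ν t count the pairs (x , y) ∈ A × B with ‖ x − y ‖ = t, so that ∑ ν = |A| |B|.  Cauchy–Schwarz
-- over the support Δ(A, B) of ν gives (∑ ν)² ≤ |Δ(A, B)| ∑ ν², so it suffices to show
-- q ∑ ν² ≤ (∑ ν)² + 2 q^d ∑ ν, i.e. ⟨ν⁰, ν⟩ ≤ 2 q^d |A| |B| for the mean-zero ν⁰ = q ν − ∑ ν.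
-- Now ⟨ν⁰, ν⟩ = ∑_{x ∈ A} h x with h z = ∑_{y ∈ B} ν⁰ ‖ z − y ‖, and after a rigid motion B lies in a
-- coordinate hyperplane z_e = 0.  There h depends on z_e = a only through a², each value has at most
-- two square roots, and what remains of ∑ h² is a sum over y, y′ ∈ B of correlations
-- ∑_{z, c} ν⁰ (‖ z − y ‖ + c) ν⁰ (‖ z − y′ ‖ + c).  These vanish for y ≠ y′: in a coordinate where y and
-- y′ differ, the difference of the two distances is affine in that coordinate with slope
-- 2 (y_j − y′_j) ≠ 0 (q is odd), and ∑ ν⁰ = 0.  Hence ∑ h² ≤ 2 q^(d−1) |B| ∑ ν⁰² = 2 q^d |B| ⟨ν⁰, ν⟩,
-- and Cauchy–Schwarz over A gives ⟨ν⁰, ν⟩² ≤ |A| ∑ h².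

module Submission where

open import Data.List using (List)
open import Data.List.Membership.Propositional using (_∈_)
open import Data.List.Relation.Unary.Unique.Propositional using (Unique)
open import Data.Nat using (ℕ)
open import Defs
open import Relation.Binary.Definitions using (DecidableEquality)

module IntegerSum where

  open import Data.Bool using (Bool; true; false; _∧_)
  open import Data.Bool.ListAction using (any)
  open import Data.Empty using (⊥-elim)
  open import Data.Integer using (ℤ; +_; -[1+_]; 0ℤ; 1ℤ; _+_; _*_; -_; _-_; _≤_; +≤+; nonNegative)
  open import Data.Integer.Properties
  open import Data.Integer.Tactic.RingSolver using (solve-∀)
  open import Data.List using (List; []; _∷_; map; concatMap; _++_; filter; length)
  import Data.Nat as ℕ
  open import Data.Product using (∃; _,_)
  open import Relation.Binary.PropositionalEquality
  open import Relation.Nullary using (¬_; yes; no)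

  sumOver : ∀ {a} {A : Set a} → List A → (A → ℤ) → ℤ
  sumOver []       f = 0ℤ
  sumOver (x ∷ xs) f = f x + sumOver xs f

  syntax sumOver xs (λ x → e) = ∑[ x ← xs ] e

  indicator : Bool → ℤ
  indicator true  = 1ℤ
  indicator false = 0ℤ

  indicator-idem : ∀ b → indicator b * indicator b ≡ indicator b
  indicator-idem true  = refl
  indicator-idem false = refl

  indicator-∧ : ∀ a b → indicator a * indicator b ≡ indicator (a ∧ b)
  indicator-∧ true  b = *-identityˡ (indicator b)
  indicator-∧ false b = refl

  0≤indicator : ∀ b → 0ℤ ≤ indicator b
  0≤indicator true  = +≤+ ℕ.z≤n
  0≤indicator false = +≤+ ℕ.z≤n

  indicator≤1 : ∀ b → indicator b ≤ 1ℤ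
  indicator≤1 true  = +≤+ (ℕ.s≤s ℕ.z≤n)
  indicator≤1 false = +≤+ ℕ.z≤n

  0≤i*i : ∀ i → 0ℤ ≤ i * i
  0≤i*i (+ 0)        = ≤-refl
  0≤i*i (+ ℕ.suc n)  = +≤+ ℕ.z≤n
  0≤i*i -[1+ n ]     = +≤+ ℕ.z≤n

  *-monoʳ-≤-0≤ : ∀ {i j k} → 0ℤ ≤ k → i ≤ j → i * k ≤ j * k
  *-monoʳ-≤-0≤ {k = k} 0≤k = *-monoʳ-≤-nonNeg k {{ nonNegative 0≤k }}

  *-monoˡ-≤-0≤ : ∀ {i j k} → 0ℤ ≤ k → i ≤ j → k * i ≤ k * j
  *-monoˡ-≤-0≤ {k = k} 0≤k = *-monoˡ-≤-nonNeg k {{ nonNegative 0≤k }}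

  0≤i*j : ∀ {i j} → 0ℤ ≤ i → 0ℤ ≤ j → 0ℤ ≤ i * j
  0≤i*j {i} {j} 0≤i 0≤j = subst (_≤ i * j) (*-zeroˡ j) (*-monoʳ-≤-0≤ 0≤j 0≤i)

  i*i≤j*i⇒i≤j : ∀ {i j} → 0ℤ ≤ i → 0ℤ ≤ j → i * i ≤ j * i → i ≤ j
  i*i≤j*i⇒i≤j {+ 0}        0≤i 0≤j _  = 0≤j
  i*i≤j*i⇒i≤j {+ ℕ.suc n} {j} _ _  ii≤ji = *-cancelʳ-≤-pos (+ ℕ.suc n) j (+ ℕ.suc n) ii≤ji

  0≤n*i⇒0≤i : ∀ n .{{_ : ℕ.NonZero n}} {i} → 0ℤ ≤ + n * i → 0ℤ ≤ i
  0≤n*i⇒0≤i (ℕ.suc n) {i} 0≤ni = *-cancelˡ-≤-pos 0ℤ i (+ ℕ.suc n) (subst (_≤ + ℕ.suc n * i) (sym (*-zeroʳ (+ ℕ.suc n))) 0≤ni)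

  module _ {a} {A : Set a} where

    sumOver-cong : ∀ (xs : List A) {f g : A → ℤ} → (∀ x → f x ≡ g x) → sumOver xs f ≡ sumOver xs g
    sumOver-cong []       eq = refl
    sumOver-cong (x ∷ xs) eq = cong₂ _+_ (eq x) (sumOver-cong xs eq)

    sumOver-zero : ∀ (xs : List A) → ∑[ x ← xs ] 0ℤ ≡ 0ℤ
    sumOver-zero []       = refl
    sumOver-zero (x ∷ xs) = trans (+-identityˡ _) (sumOver-zero xs)

    sumOver-distrib-+ : ∀ (xs : List A) (f g : A → ℤ) → ∑[ x ← xs ] (f x + g x) ≡ sumOver xs f + sumOver xs g
    sumOver-distrib-+ []       f g = refl
    sumOver-distrib-+ (x ∷ xs) f g = trans (cong (_+_ (f x + g x)) (sumOver-distrib-+ xs f g)) (interchange (f x) (g x) _ _)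
      where
      interchange : ∀ a b c d → (a + b) + (c + d) ≡ (a + c) + (b + d)
      interchange = solve-∀

    *-distribˡ-sumOver : ∀ (xs : List A) c (f : A → ℤ) → c * sumOver xs f ≡ ∑[ x ← xs ] (c * f x)
    *-distribˡ-sumOver []       c f = *-zeroʳ c
    *-distribˡ-sumOver (x ∷ xs) c f = trans (*-distribˡ-+ c (f x) _) (cong (_+_ (c * f x)) (*-distribˡ-sumOver xs c f))

    *-distribʳ-sumOver : ∀ (xs : List A) c (f : A → ℤ) → sumOver xs f * c ≡ ∑[ x ← xs ] (f x * c)
    *-distribʳ-sumOver xs c f =
      trans (*-comm _ c) (trans (*-distribˡ-sumOver xs c f) (sumOver-cong xs (λ x → *-comm c (f x))))

    neg-distrib-sumOver : ∀ (xs : List A) (f : A → ℤ) → - sumOver xs f ≡ ∑[ x ← xs ] (- f x)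
    neg-distrib-sumOver []       f = refl
    neg-distrib-sumOver (x ∷ xs) f = trans (neg-distrib-+ (f x) _) (cong (_+_ (- f x)) (neg-distrib-sumOver xs f))

    sumOver-distrib-- : ∀ (xs : List A) (f g : A → ℤ) → ∑[ x ← xs ] (f x - g x) ≡ sumOver xs f - sumOver xs g
    sumOver-distrib-- xs f g =
      trans (sumOver-distrib-+ xs f (λ x → - g x)) (cong (_+_ (sumOver xs f)) (sym (neg-distrib-sumOver xs g)))

    sumOver-const : ∀ (xs : List A) c → ∑[ x ← xs ] c ≡ c * + length xs
    sumOver-const []       c = sym (*-zeroʳ c)
    sumOver-const (x ∷ xs) c = begin
      c + sumOver xs (λ _ → c)   ≡⟨ cong (_+_ c) (sumOver-const xs c) ⟩
      c + c * + length xs        ≡⟨ cong (_+ c * + length xs) (sym (*-identityʳ c)) ⟩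
      c * 1ℤ + c * + length xs   ≡⟨ sym (*-distribˡ-+ c 1ℤ (+ length xs)) ⟩
      c * + ℕ.suc (length xs)    ∎
      where open ≡-Reasoning

    sumOver-mono-≤ : ∀ (xs : List A) {f g : A → ℤ} → (∀ x → f x ≤ g x) → sumOver xs f ≤ sumOver xs g
    sumOver-mono-≤ []       le = ≤-refl
    sumOver-mono-≤ (x ∷ xs) le = +-mono-≤ (le x) (sumOver-mono-≤ xs le)

    sumOver-nonNeg : ∀ (xs : List A) {f : A → ℤ} → (∀ x → 0ℤ ≤ f x) → 0ℤ ≤ sumOver xs f
    sumOver-nonNeg xs {f} le = subst (_≤ sumOver xs f) (sumOver-zero xs) (sumOver-mono-≤ xs le)

    sumOver-++ : ∀ (xs ys : List A) (f : A → ℤ) → sumOver (xs ++ ys) f ≡ sumOver xs f + sumOver ys f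
    sumOver-++ []       ys f = sym (+-identityˡ _)
    sumOver-++ (x ∷ xs) ys f = trans (cong (_+_ (f x)) (sumOver-++ xs ys f)) (sym (+-assoc (f x) _ _))

    length-filter≡sumOver : ∀ (xs : List A) (P : A → Bool) →
      + length (filter (λ x → P x Data.Bool.≟ true) xs) ≡ ∑[ x ← xs ] indicator (P x)
    length-filter≡sumOver []       P = refl
    length-filter≡sumOver (x ∷ xs) P with P x
    ... | true  = cong (_+_ 1ℤ) (length-filter≡sumOver xs P)
    ... | false = trans (length-filter≡sumOver xs P) (sym (+-identityˡ _))

  module _ {a b} {A : Set a} {B : Set b} where

    sumOver-map : ∀ (xs : List A) (h : A → B) (f : B → ℤ) → sumOver (map h xs) f ≡ ∑[ x ← xs ] f (h x)
    sumOver-map []       h f = refl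
    sumOver-map (x ∷ xs) h f = cong (_+_ (f (h x))) (sumOver-map xs h f)

    sumOver-concatMap : ∀ (xs : List A) (h : A → List B) (f : B → ℤ) →
      sumOver (concatMap h xs) f ≡ ∑[ x ← xs ] sumOver (h x) f
    sumOver-concatMap []       h f = refl
    sumOver-concatMap (x ∷ xs) h f =
      trans (sumOver-++ (h x) (concatMap h xs) f) (cong (_+_ (sumOver (h x) f)) (sumOver-concatMap xs h f))

    sumOver-comm : ∀ (xs : List A) (ys : List B) (f : A → B → ℤ) →
      ∑[ x ← xs ] ∑[ y ← ys ] f x y ≡ ∑[ y ← ys ] ∑[ x ← xs ] f x y
    sumOver-comm []       ys f = sym (sumOver-zero ys)
    sumOver-comm (x ∷ xs) ys f =
      trans (cong (_+_ (sumOver ys (f x))) (sumOver-comm xs ys f)) (sym (sumOver-distrib-+ ys (f x) _))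

    sumOver-product : ∀ (xs : List A) (ys : List B) (f : A → ℤ) (g : B → ℤ) →
      sumOver xs f * sumOver ys g ≡ ∑[ x ← xs ] ∑[ y ← ys ] (f x * g y)
    sumOver-product xs ys f g =
      trans (*-distribʳ-sumOver xs _ f) (sumOver-cong xs (λ x → *-distribˡ-sumOver ys (f x) g))

  module _ {a} {A : Set a} where

    sumOver-square-expand : ∀ (xs : List A) (f g : A → ℤ) p r →
      ∑[ x ← xs ] ((p * g x - r * f x) * (p * g x - r * f x))
        ≡ p * p * ∑[ x ← xs ] (g x * g x) - (p * r * ∑[ x ← xs ] (f x * g x)) * + 2 + r * r * ∑[ x ← xs ] (f x * f x)
    sumOver-square-expand []       f g p r = zeroes p r
      where
      zeroes : ∀ p r → 0ℤ ≡ p * p * 0ℤ - (p * r * 0ℤ) * + 2 + r * r * 0ℤ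
      zeroes = solve-∀
    sumOver-square-expand (x ∷ xs) f g p r =
      trans (cong (_+_ ((p * g x - r * f x) * (p * g x - r * f x))) (sumOver-square-expand xs f g p r))
            (step p r (f x) (g x) _ _ _)
      where
      step : ∀ p r a b F G FG →
        (p * b - r * a) * (p * b - r * a) + (p * p * G - (p * r * FG) * + 2 + r * r * F)
          ≡ p * p * (b * b + G) - (p * r * (a * b + FG)) * + 2 + r * r * (a * a + F)
      step = solve-∀

    -- Lagrange's identity, peeled off one term at a time.
    cauchy-schwarz : ∀ (xs : List A) (f g : A → ℤ) →
      ∑[ x ← xs ] (f x * g x) * ∑[ x ← xs ] (f x * g x) ≤ ∑[ x ← xs ] (f x * f x) * ∑[ x ← xs ] (g x * g x)
    cauchy-schwarz []       f g = ≤-refl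
    cauchy-schwarz (x ∷ xs) f g = 0≤i-j⇒j≤i (subst (0ℤ ≤_) (sym (split (f x) (g x) _ _ _))
        (+-mono-≤ (i≤j⇒0≤j-i (cauchy-schwarz xs f g))
                  (subst (0ℤ ≤_) (sumOver-square-expand xs f g (f x) (g x))
                         (sumOver-nonNeg xs (λ y → 0≤i*i (f x * g y - g x * f y))))))
      where
      split : ∀ a b F G FG → (a * a + F) * (b * b + G) - (a * b + FG) * (a * b + FG)
                             ≡ (F * G - FG * FG) + (a * a * G - (a * b * FG) * + 2 + b * b * F)
      split = solve-∀

    sumOver-≢0⇒∃≢0 : ∀ (xs : List A) (f : A → ℤ) → ¬ sumOver xs f ≡ 0ℤ → ∃ λ x → ¬ f x ≡ 0ℤ
    sumOver-≢0⇒∃≢0 []       f sum≢0 = ⊥-elim (sum≢0 refl)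
    sumOver-≢0⇒∃≢0 (x ∷ xs) f sum≢0 with f x ≟ 0ℤ
    ... | no  fx≢0 = x , fx≢0
    ... | yes fx≡0 = sumOver-≢0⇒∃≢0 xs f (λ rest≡0 → sum≢0 (cong₂ _+_ fx≡0 rest≡0))

    any≡false⇒sumOver≡0 : ∀ (xs : List A) (p : A → Bool) (f : A → ℤ) →
      any p xs ≡ false → (∀ x → p x ≡ false → f x ≡ 0ℤ) → sumOver xs f ≡ 0ℤ
    any≡false⇒sumOver≡0 []       p f _ _ = refl
    any≡false⇒sumOver≡0 (x ∷ xs) p f none f≡0 with p x in px
    ... | false = cong₂ _+_ (f≡0 x px) (any≡false⇒sumOver≡0 xs p f none f≡0)

module Enumeration {a} {A : Set a} (_≟_ : DecidableEquality A)
                   (xs : List A) (unique : Unique xs) (complete : ∀ x → x ∈ xs) where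

  open import Data.Empty using (⊥-elim)
  open import Data.List using ([]; _∷_; length)
  open import Data.List.Membership.Propositional using (_∉_)
  open import Data.Integer using (ℤ; +_; -[1+_]; 0ℤ; 1ℤ; _+_; _*_; _≤_)
  open import Data.Integer.Properties using (*-identityˡ; +-identityˡ; +-identityʳ; +-injective)
  open import Data.List.Relation.Unary.All.Properties using (All¬⇒¬Any)
  open import Data.List.Relation.Unary.Any using (here; there)
  open import Data.List.Relation.Unary.AllPairs using (_∷_)
  import Data.Nat as ℕ
  import Data.Nat.Properties as ℕ
  open import Data.Nat.Divisibility using (_∣_; divides)
  open import Relation.Binary.Definitions using (tri<; tri≈; tri>)
  open import Relation.Binary.PropositionalEquality
  open import Relation.Nullary using (¬_; yes; no)
  open import Relation.Nullary.Decidable using (⌊_⌋)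
  open IntegerSum

  ⟦_≟_⟧ : A → A → ℤ
  ⟦ x ≟ y ⟧ = indicator ⌊ x ≟ y ⌋

  0≤⟦≟⟧ : ∀ x y → 0ℤ ≤ ⟦ x ≟ y ⟧
  0≤⟦≟⟧ x y = 0≤indicator ⌊ x ≟ y ⌋

  ⟦≟⟧-≡ : ∀ {x y} → x ≡ y → ⟦ x ≟ y ⟧ ≡ 1ℤ
  ⟦≟⟧-≡ {x} {y} x≡y with x ≟ y
  ... | yes _   = refl
  ... | no  x≢y = ⊥-elim (x≢y x≡y)

  ⟦≟⟧-≢ : ∀ {x y} → ¬ x ≡ y → ⟦ x ≟ y ⟧ ≡ 0ℤ
  ⟦≟⟧-≢ {x} {y} x≢y with x ≟ y
  ... | yes x≡y = ⊥-elim (x≢y x≡y)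
  ... | no  _   = refl

  ⟦≟⟧-≢0 : ∀ {x y} → ¬ ⟦ x ≟ y ⟧ ≡ 0ℤ → x ≡ y
  ⟦≟⟧-≢0 {x} {y} ⟦x≟y⟧≢0 with x ≟ y
  ... | yes x≡y = x≡y
  ... | no  _   = ⊥-elim (⟦x≟y⟧≢0 refl)

  ⟦≟⟧-cong : ∀ {x y u v} → (x ≡ y → u ≡ v) → (u ≡ v → x ≡ y) → ⟦ x ≟ y ⟧ ≡ ⟦ u ≟ v ⟧
  ⟦≟⟧-cong {x} {y} to from with x ≟ y
  ... | yes x≡y = sym (⟦≟⟧-≡ (to x≡y))
  ... | no  x≢y = sym (⟦≟⟧-≢ (λ u≡v → x≢y (from u≡v)))

  ⟦≟⟧-sym : ∀ x y → ⟦ x ≟ y ⟧ ≡ ⟦ y ≟ x ⟧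
  ⟦≟⟧-sym x y = ⟦≟⟧-cong sym sym

  sift-∉ : ∀ {ys : List A} {c} → c ∉ ys → (g : A → ℤ) → ∑[ y ← ys ] (⟦ y ≟ c ⟧ * g y) ≡ 0ℤ
  sift-∉ {[]}     c∉ys g = refl
  sift-∉ {y ∷ ys} c∉ys g =
    cong₂ _+_ (cong (_* g y) (⟦≟⟧-≢ (λ y≡c → c∉ys (here (sym y≡c))))) (sift-∉ (λ c∈ys → c∉ys (there c∈ys)) g)

  sift : ∀ {ys : List A} {c} → Unique ys → c ∈ ys → (g : A → ℤ) → ∑[ y ← ys ] (⟦ y ≟ c ⟧ * g y) ≡ g c
  sift {y ∷ ys} {c} (y∉ys ∷ unique-ys) c∈y∷ys g with y ≟ c | c∈y∷ys
  ... | yes refl | _          = trans (cong (_+_ (1ℤ * g y)) (sift-∉ (All¬⇒¬Any y∉ys) g)) (trans (+-identityʳ _) (*-identityˡ (g y)))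
  ... | no y≢c   | here c≡y   = ⊥-elim (y≢c (sym c≡y))
  ... | no y≢c   | there c∈ys = trans (+-identityˡ _) (sift unique-ys c∈ys g)

  sum-sift : ∀ c (g : A → ℤ) → ∑[ x ← xs ] (⟦ x ≟ c ⟧ * g x) ≡ g c
  sum-sift c = sift unique (complete c)

  -- Expanding f (σ x) as a sum over an indicator turns the reindexing into an exchange of sums.
  sum-reindex : ∀ (σ τ : A → A) → (∀ x → τ (σ x) ≡ x) → (∀ y → σ (τ y) ≡ y) →
    ∀ f → ∑[ x ← xs ] f (σ x) ≡ sumOver xs f
  sum-reindex σ τ τσ στ f = begin
    ∑[ x ← xs ] f (σ x)
      ≡⟨ sumOver-cong xs (λ x → sym (sum-sift (σ x) f)) ⟩
    ∑[ x ← xs ] ∑[ y ← xs ] (⟦ y ≟ σ x ⟧ * f y)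
      ≡⟨ sumOver-comm xs xs _ ⟩
    ∑[ y ← xs ] ∑[ x ← xs ] (⟦ y ≟ σ x ⟧ * f y)
      ≡⟨ sumOver-cong xs (λ y → sumOver-cong xs (λ x → cong (_* f y) (⟦≟⟧-cong (to y x) (from y x)))) ⟩
    ∑[ y ← xs ] ∑[ x ← xs ] (⟦ x ≟ τ y ⟧ * f y)
      ≡⟨ sumOver-cong xs (λ y → sum-sift (τ y) (λ _ → f y)) ⟩
    sumOver xs f
      ∎
    where
    open ≡-Reasoning
    to : ∀ y x → y ≡ σ x → x ≡ τ y
    to y x y≡σx = trans (sym (τσ x)) (cong τ (sym y≡σx))
    from : ∀ y x → x ≡ τ y → y ≡ σ x
    from y x x≡τy = trans (sym (στ y)) (cong σ (sym x≡τy))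

  -- Each orbit {x, σ x} contributes exactly one element x with rank x < rank (σ x).
  involution⇒even : (rank : A → ℕ.ℕ) → (∀ {x y} → rank x ≡ rank y → x ≡ y) →
    (σ : A → A) → (∀ x → σ (σ x) ≡ x) → (∀ x → ¬ σ x ≡ x) → 2 ∣ length xs
  involution⇒even rank rank-injective σ σσ σ-noFix = even (sumOver xs g) twice
    where
    g : A → ℤ
    g x = indicator ⌊ rank x ℕ.<? rank (σ x) ⌋
    exactlyOne : ∀ x → indicator ⌊ rank x ℕ.<? rank (σ x) ⌋ + indicator ⌊ rank (σ x) ℕ.<? rank x ⌋ ≡ 1ℤ
    exactlyOne x with rank x ℕ.<? rank (σ x) | rank (σ x) ℕ.<? rank x
    ... | yes r<s | yes s<r = ⊥-elim (ℕ.<-asym r<s s<r)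
    ... | yes _   | no _    = refl
    ... | no _    | yes _   = refl
    ... | no r≮s  | no s≮r  with ℕ.<-cmp (rank x) (rank (σ x))
    ...   | tri< r<s _ _ = ⊥-elim (r≮s r<s)
    ...   | tri≈ _ r≡s _ = ⊥-elim (σ-noFix x (sym (rank-injective r≡s)))
    ...   | tri> _ _ s<r = ⊥-elim (s≮r s<r)
    pair : ∀ x → g x + g (σ x) ≡ 1ℤ
    pair x = trans (cong (λ y → g x + indicator ⌊ rank (σ x) ℕ.<? rank y ⌋) (σσ x)) (exactlyOne x)
    twice : sumOver xs g + sumOver xs g ≡ + length xs
    twice = begin
      sumOver xs g + sumOver xs g                ≡⟨ cong (_+_ (sumOver xs g)) (sym (sum-reindex σ σ σσ σσ g)) ⟩
      sumOver xs g + ∑[ x ← xs ] g (σ x)         ≡⟨ sym (sumOver-distrib-+ xs g (λ x → g (σ x))) ⟩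
      ∑[ x ← xs ] (g x + g (σ x))                ≡⟨ sumOver-cong xs pair ⟩
      ∑[ x ← xs ] 1ℤ                             ≡⟨ sumOver-const xs 1ℤ ⟩
      1ℤ * + length xs                           ≡⟨ *-identityˡ _ ⟩
      + length xs                                ∎
      where open ≡-Reasoning
    even : ∀ s → s + s ≡ + length xs → 2 ∣ length xs
    even (+ n)     n+n≡len = divides n (trans (sym (+-injective n+n≡len)) (trans (cong (n ℕ.+_) (sym (ℕ.+-identityʳ n))) (ℕ.*-comm 2 n)))
    even -[1+ n ] ()

module FieldBasics {q : ℕ} (𝔽 : FiniteField q) where

  open import Algebra.Bundles using (CommutativeRing)
  import Algebra.Properties.AbelianGroup as AbelianGroupProperties
  import Algebra.Properties.Ring as RingProperties
  import Algebra.Solver.CommutativeMonoid as CommutativeMonoidSolver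
  open import Data.Product using (_,_)
  open import Data.Sum using (_⊎_; inj₁; inj₂)
  open import Relation.Binary.PropositionalEquality
  open import Relation.Nullary using (yes; no)

  open FiniteField 𝔽 public
  open FF 𝔽 public

  commutativeRing : CommutativeRing _ _
  commutativeRing = record { isCommutativeRing = isCommutativeRing }

  open CommutativeRing commutativeRing public
    using ( +-comm; +-assoc; +-identityˡ; +-identityʳ; -‿inverseˡ; -‿inverseʳ
          ; *-comm; *-assoc; *-identityˡ; distribˡ; distribʳ; zeroˡ; zeroʳ
          ; +-commutativeMonoid; *-commutativeMonoid; ring; +-abelianGroup)
  open RingProperties ring public using (-‿distribˡ-*; -‿distribʳ-*; -0#≈0#; -‿involutive; x∙y⁻¹≈ε⇒x≈y)
  open AbelianGroupProperties +-abelianGroup public using (⁻¹-∙-comm)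

  module +-Solver = CommutativeMonoidSolver +-commutativeMonoid
  module *-Solver = CommutativeMonoidSolver *-commutativeMonoid

  infixl 6 _−_
  _−_ : F → F → F
  x − y = x + - y

  x−x≡0 : ∀ x → x − x ≡ 0#
  x−x≡0 = -‿inverseʳ

  x−0≡x : ∀ x → x − 0# ≡ x
  x−0≡x x = trans (cong (x +_) -0#≈0#) (+-identityʳ x)

  x−y≡0⇒x≡y : ∀ {x y} → x − y ≡ 0# → x ≡ y
  x−y≡0⇒x≡y = x∙y⁻¹≈ε⇒x≈y _ _

  neg-distrib-+ : ∀ x y → - (x + y) ≡ - x + - y
  neg-distrib-+ x y = sym (⁻¹-∙-comm x y)

  [x+y]−y≡x : ∀ x y → (x + y) − y ≡ x
  [x+y]−y≡x x y = trans (+-assoc x y (- y)) (trans (cong (x +_) (x−x≡0 y)) (+-identityʳ x))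

  [x−y]+y≡x : ∀ x y → (x − y) + y ≡ x
  [x−y]+y≡x x y = trans (+-assoc x (- y) y) (trans (cong (x +_) (-‿inverseˡ y)) (+-identityʳ x))

  [x+z]−[y+z]≡x−y : ∀ x y z → (x + z) − (y + z) ≡ x − y
  [x+z]−[y+z]≡x−y x y z = begin
    (x + z) + - (y + z)     ≡⟨ cong ((x + z) +_) (neg-distrib-+ y z) ⟩
    (x + z) + (- y + - z)   ≡⟨ solve 4 (λ a b c d → (a ⊕ c) ⊕ (b ⊕ d) ⊜ (a ⊕ b) ⊕ (c ⊕ d)) refl x (- y) z (- z) ⟩
    (x + - y) + (z + - z)   ≡⟨ cong ((x + - y) +_) (x−x≡0 z) ⟩
    (x + - y) + 0#          ≡⟨ +-identityʳ _ ⟩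
    x − y                   ∎
    where
    open ≡-Reasoning
    open +-Solver

  x*y≡0⇒x≡0⊎y≡0 : ∀ x y → x * y ≡ 0# → x ≡ 0# ⊎ y ≡ 0#
  x*y≡0⇒x≡0⊎y≡0 x y xy≡0 with x ≟ 0#
  ... | yes x≡0 = inj₁ x≡0
  ... | no  x≢0 with inverse x x≢0
  ...   | x⁻¹ , xx⁻¹≡1 = inj₂ (begin
    y                 ≡⟨ sym (*-identityˡ y) ⟩
    1# * y            ≡⟨ cong (_* y) (trans (sym xx⁻¹≡1) (*-comm x x⁻¹)) ⟩
    (x⁻¹ * x) * y     ≡⟨ *-assoc x⁻¹ x y ⟩
    x⁻¹ * (x * y)     ≡⟨ cong (x⁻¹ *_) xy≡0 ⟩
    x⁻¹ * 0#          ≡⟨ zeroʳ x⁻¹ ⟩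
    0#                ∎)
    where open ≡-Reasoning

  [x−y][x+y]≡x²−y² : ∀ x y → (x − y) * (x + y) ≡ x * x − y * y
  [x−y][x+y]≡x²−y² x y = begin
    (x + - y) * (x + y)
      ≡⟨ distribʳ (x + y) x (- y) ⟩
    x * (x + y) + - y * (x + y)
      ≡⟨ cong₂ _+_ (distribˡ x x y) (distribˡ (- y) x y) ⟩
    (x * x + x * y) + (- y * x + - y * y)
      ≡⟨ cong₂ (λ s t → (x * x + x * y) + (s + t)) (trans (sym (-‿distribˡ-* y x)) (cong -_ (*-comm y x))) (sym (-‿distribˡ-* y y)) ⟩
    (x * x + x * y) + (- (x * y) + - (y * y))
      ≡⟨ solve 4 (λ a b c d → (a ⊕ b) ⊕ (c ⊕ d) ⊜ (a ⊕ d) ⊕ (b ⊕ c)) refl (x * x) (x * y) (- (x * y)) (- (y * y)) ⟩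
    (x * x − y * y) + (x * y − x * y)
      ≡⟨ cong ((x * x − y * y) +_) (x−x≡0 (x * y)) ⟩
    (x * x − y * y) + 0#
      ≡⟨ +-identityʳ _ ⟩
    x * x − y * y
      ∎
    where
    open ≡-Reasoning
    open +-Solver

  x²≡y²⇒x≡y⊎x≡-y : ∀ x y → x * x ≡ y * y → x ≡ y ⊎ x ≡ - y
  x²≡y²⇒x≡y⊎x≡-y x y x²≡y² with x*y≡0⇒x≡0⊎y≡0 (x − y) (x + y) (trans ([x−y][x+y]≡x²−y² x y) (trans (cong (_− y * y) x²≡y²) (x−x≡0 (y * y))))
  ... | inj₁ x−y≡0 = inj₁ (x−y≡0⇒x≡y x−y≡0)
  ... | inj₂ x+y≡0 = inj₂ (trans (sym ([x+y]−y≡x x y)) (trans (cong (_− y) x+y≡0) (+-identityˡ (- y))))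

  [x+u]−[y+w]≡[x−y]+[u−w] : ∀ x y u w → (x + u) − (y + w) ≡ (x − y) + (u − w)
  [x+u]−[y+w]≡[x−y]+[u−w] x y u w = trans (cong ((x + u) +_) (neg-distrib-+ y w))
    (solve 4 (λ a b c e → (a ⊕ b) ⊕ (c ⊕ e) ⊜ (a ⊕ c) ⊕ (b ⊕ e)) refl x u (- y) (- w))
    where open +-Solver

  [x−y]²−[x−z]²≡[z−y][2x−[y+z]] : ∀ x y z → (x − y) * (x − y) − (x − z) * (x − z) ≡ (z − y) * ((x + x) − (y + z))
  [x−y]²−[x−z]²≡[z−y][2x−[y+z]] x y z = begin
    (x − y) * (x − y) − (x − z) * (x − z)     ≡⟨ sym ([x−y][x+y]≡x²−y² (x − y) (x − z)) ⟩
    ((x − y) − (x − z)) * ((x − y) + (x − z)) ≡⟨ cong₂ _*_ difference sum ⟩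
    (z − y) * ((x + x) − (y + z))             ∎
    where
    open ≡-Reasoning
    open +-Solver
    difference : (x − y) − (x − z) ≡ z − y
    difference = begin
      (x − y) − (x − z)     ≡⟨ [x+u]−[y+w]≡[x−y]+[u−w] x x (- y) (- z) ⟩
      (x − x) + (- y − - z) ≡⟨ cong₂ _+_ (x−x≡0 x) (cong (- y +_) (-‿involutive z)) ⟩
      0# + (- y + z)        ≡⟨ trans (+-identityˡ _) (+-comm (- y) z) ⟩
      z − y                 ∎
    sum : (x − y) + (x − z) ≡ (x + x) − (y + z)
    sum = trans (solve 4 (λ a b c e → (a ⊕ b) ⊕ (c ⊕ e) ⊜ (a ⊕ c) ⊕ (b ⊕ e)) refl x (- y) x (- z))
                (cong ((x + x) +_) (sym (neg-distrib-+ y z)))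

module FieldSums {q : ℕ} (𝔽 : FiniteField q) where

  open import Data.Fin using (Fin; toℕ)
  open import Data.Fin.Properties using (toℕ-injective; nonZeroIndex)
  open import Data.Integer using (ℤ; +_; 0ℤ; 1ℤ; _≤_; +≤+) renaming (_+_ to _+ℤ_; _*_ to _*ℤ_)
  import Data.Integer.Properties as ℤ
  open import Data.List using (allFin; length)
  open import Data.List.Membership.Propositional using (_∈_)
  open import Data.List.Membership.Propositional.Properties using (∈-map⁺; ∈-allFin)
  open import Data.List.Properties using (length-map; length-tabulate)
  open import Data.List.Relation.Unary.Unique.Propositional using (Unique)
  open import Data.List.Relation.Unary.Unique.Propositional.Properties using (map⁺; allFin⁺)
  import Data.Nat as ℕ
  open import Data.Nat.Divisibility using (_∣_; ∣1⇒≡1)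
  open import Data.Nat.Primality using (euclidsLemma; prime[2])
  open import Data.Product using (_,_)
  open import Data.Sum using (inj₁; inj₂)
  open import Function.Bundles using (Inverse)
  open import Relation.Binary.PropositionalEquality
  open import Relation.Nullary using (¬_; yes; no)
  open FieldBasics 𝔽
  open IntegerSum

  private
    toF : Fin q → F
    toF = Inverse.to enumeration

    fromF : F → Fin q
    fromF = Inverse.from enumeration

    fromF-injective : ∀ {a b} → fromF a ≡ fromF b → a ≡ b
    fromF-injective {a} {b} eq =
      trans (sym (Inverse.strictlyInverseˡ enumeration a)) (trans (cong toF eq) (Inverse.strictlyInverseˡ enumeration b))

    toF-injective : ∀ {i j} → toF i ≡ toF j → i ≡ j
    toF-injective {i} {j} eq =
      trans (sym (Inverse.strictlyInverseʳ enumeration i)) (trans (cong fromF eq) (Inverse.strictlyInverseʳ enumeration j))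

  elems-unique : Unique elems
  elems-unique = map⁺ toF-injective (allFin⁺ q)

  ∈-elems : ∀ a → a ∈ elems
  ∈-elems a = subst (_∈ elems) (Inverse.strictlyInverseˡ enumeration a) (∈-map⁺ toF (∈-allFin (fromF a)))

  q-nonZero : ℕ.NonZero q
  q-nonZero = nonZeroIndex (fromF 0#)

  length-elems : length elems ≡ q
  length-elems = trans (length-map toF (allFin q)) (length-tabulate (λ i → i))

  open Enumeration _≟_ elems elems-unique ∈-elems public

  sum-elems-const : ∀ c → ∑[ a ← elems ] c ≡ c *ℤ + q
  sum-elems-const c = trans (sumOver-const elems c) (cong (λ n → c *ℤ + n) length-elems)

  sum-translate : ∀ s (f : F → ℤ) → ∑[ a ← elems ] f (a + s) ≡ sumOver elems f
  sum-translate s = sum-reindex (_+ s) (_− s) (λ a → [x+y]−y≡x a s) (λ c → [x−y]+y≡x c s)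

  sum-scale : ∀ α → ¬ α ≡ 0# → (f : F → ℤ) → ∑[ a ← elems ] f (α * a) ≡ sumOver elems f
  sum-scale α α≢0 with inverse α α≢0
  ... | α⁻¹ , αα⁻¹≡1 = sum-reindex (α *_) (α⁻¹ *_) (cancel α⁻¹ α (trans (*-comm α⁻¹ α) αα⁻¹≡1)) (cancel α α⁻¹ αα⁻¹≡1)
    where
    cancel : ∀ x y → x * y ≡ 1# → ∀ a → x * (y * a) ≡ a
    cancel x y xy≡1 a = trans (sym (*-assoc x y a)) (trans (cong (_* a) xy≡1) (*-identityˡ a))

  -- In characteristic 2, a ↦ a + 1 would be a fixed-point-free involution, forcing q to be even.
  1+1≢0 : OddPrimePower q → ¬ 1# + 1# ≡ 0#
  1+1≢0 (p , n , p-prime , 2∤p , _ , q≡pⁿ) 1+1≡0 =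
    2∤pⁿ n (subst (2 ∣_) (trans length-elems q≡pⁿ)
                   (involution⇒even (λ a → toℕ (fromF a)) (λ eq → fromF-injective (toℕ-injective eq)) (_+ 1#) +1+1 +1≢id))
    where
    +1+1 : ∀ a → (a + 1#) + 1# ≡ a
    +1+1 a = trans (+-assoc a 1# 1#) (trans (cong (_+_ a) 1+1≡0) (+-identityʳ a))
    +1≢id : ∀ a → ¬ a + 1# ≡ a
    +1≢id a a+1≡a = 0≢1 (sym (trans (sym ([x+y]−y≡x 1# a)) (trans (cong (_− a) (trans (+-comm 1# a) a+1≡a)) (x−x≡0 a))))
    2∤pⁿ : ∀ n → ¬ 2 ∣ p ℕ.^ n
    2∤pⁿ ℕ.zero    2∣1 with ∣1⇒≡1 2∣1
    ... | ()
    2∤pⁿ (ℕ.suc n) 2∣pⁿ⁺¹ with euclidsLemma p (p ℕ.^ n) prime[2] 2∣pⁿ⁺¹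
    ... | inj₁ 2∣p  = 2∤p 2∣p
    ... | inj₂ 2∣pⁿ = 2∤pⁿ n 2∣pⁿ

  -- Once c = a₀², every square root of c is ± a₀.
  #square-roots≤2 : ∀ c → ∑[ a ← elems ] ⟦ c ≟ a * a ⟧ ≤ + 2
  #square-roots≤2 c with ℤ._≟_ (∑[ a ← elems ] ⟦ c ≟ a * a ⟧) 0ℤ
  ... | yes none = subst (_≤ + 2) (sym none) (+≤+ ℕ.z≤n)
  ... | no some with sumOver-≢0⇒∃≢0 elems (λ a → ⟦ c ≟ a * a ⟧) some
  ...   | a₀ , c≡a₀² = ℤ.≤-trans (sumOver-mono-≤ elems ≤±a₀)
                          (ℤ.≤-reflexive (trans (sumOver-distrib-+ elems _ _) (cong₂ _+ℤ_ (count a₀) (count (- a₀)))))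
    where
    ≤±a₀ : ∀ a → ⟦ c ≟ a * a ⟧ ≤ ⟦ a ≟ a₀ ⟧ +ℤ ⟦ a ≟ - a₀ ⟧
    ≤±a₀ a with c ≟ (a * a)
    ... | no _     = ℤ.+-mono-≤ (0≤⟦≟⟧ a a₀) (0≤⟦≟⟧ a (- a₀))
    ... | yes c≡a² with x²≡y²⇒x≡y⊎x≡-y a a₀ (trans (sym c≡a²) (⟦≟⟧-≢0 c≡a₀²))
    ...   | inj₁ a≡a₀  = ℤ.+-mono-≤ (ℤ.≤-reflexive (sym (⟦≟⟧-≡ a≡a₀))) (0≤⟦≟⟧ a (- a₀))
    ...   | inj₂ a≡-a₀ = ℤ.+-mono-≤ (0≤⟦≟⟧ a a₀) (ℤ.≤-reflexive (sym (⟦≟⟧-≡ a≡-a₀)))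
    count : ∀ b → ∑[ a ← elems ] ⟦ a ≟ b ⟧ ≡ 1ℤ
    count b = trans (sumOver-cong elems (λ a → sym (ℤ.*-identityʳ _))) (sum-sift b (λ _ → 1ℤ))

  sum-squares≤ : ∀ (G : F → ℤ) → (∀ c → 0ℤ ≤ G c) → ∑[ a ← elems ] G (a * a) ≤ + 2 *ℤ sumOver elems G
  sum-squares≤ G G≥0 = begin
    ∑[ a ← elems ] G (a * a)
      ≡⟨ sumOver-cong elems (λ a → sym (sum-sift (a * a) G)) ⟩
    ∑[ a ← elems ] ∑[ c ← elems ] (⟦ c ≟ a * a ⟧ *ℤ G c)
      ≡⟨ sumOver-comm elems elems _ ⟩
    ∑[ c ← elems ] ∑[ a ← elems ] (⟦ c ≟ a * a ⟧ *ℤ G c)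
      ≡⟨ sumOver-cong elems (λ c → sym (*-distribʳ-sumOver elems (G c) _)) ⟩
    ∑[ c ← elems ] (∑[ a ← elems ] ⟦ c ≟ a * a ⟧ *ℤ G c)
      ≤⟨ sumOver-mono-≤ elems (λ c → *-monoʳ-≤-0≤ (G≥0 c) (#square-roots≤2 c)) ⟩
    ∑[ c ← elems ] (+ 2 *ℤ G c)
      ≡⟨ sym (*-distribˡ-sumOver elems (+ 2) G) ⟩
    + 2 *ℤ sumOver elems G
      ∎
    where open ℤ.≤-Reasoning

module FinSum {q : ℕ} (𝔽 : FiniteField q) where

  open import Data.Empty using (⊥-elim)
  open import Data.Fin using (Fin; zero; suc; punchIn; punchOut)
  import Data.Fin as Fin
  open import Data.Fin.Properties using (punchInᵢ≢i)
  import Data.Nat as ℕ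
  open import Data.Vec.Functional using (insertAt; removeAt)
  open import Data.Vec.Functional.Properties using (insertAt-lookup; insertAt-punchIn; removeAt-punchOut)
  open import Relation.Binary.PropositionalEquality
  open import Relation.Nullary using (¬_; yes; no)
  open FieldBasics 𝔽

  ∑-cong : ∀ n {f g : Fin n → F} → f ≗ g → ∑ n f ≡ ∑ n g
  ∑-cong ℕ.zero    f≗g = refl
  ∑-cong (ℕ.suc n) f≗g = cong₂ _+_ (f≗g zero) (∑-cong n (λ i → f≗g (suc i)))

  ∑-zero : ∀ n → ∑ n (λ _ → 0#) ≡ 0#
  ∑-zero ℕ.zero    = refl
  ∑-zero (ℕ.suc n) = trans (+-identityˡ _) (∑-zero n)

  ∑-distrib-+ : ∀ n (f g : Fin n → F) → ∑ n (λ i → f i + g i) ≡ ∑ n f + ∑ n g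
  ∑-distrib-+ ℕ.zero    f g = sym (+-identityˡ 0#)
  ∑-distrib-+ (ℕ.suc n) f g = trans (cong (f zero + g zero +_) (∑-distrib-+ n (λ i → f (suc i)) (λ i → g (suc i))))
    (solve 4 (λ a b c d → (a ⊕ b) ⊕ (c ⊕ d) ⊜ (a ⊕ c) ⊕ (b ⊕ d)) refl (f zero) (g zero) _ _)
    where open +-Solver

  *-distribˡ-∑ : ∀ n c (f : Fin n → F) → c * ∑ n f ≡ ∑ n (λ i → c * f i)
  *-distribˡ-∑ ℕ.zero    c f = zeroʳ c
  *-distribˡ-∑ (ℕ.suc n) c f = trans (distribˡ c _ _) (cong (c * f zero +_) (*-distribˡ-∑ n c (λ i → f (suc i))))

  *-distribʳ-∑ : ∀ n c (f : Fin n → F) → ∑ n f * c ≡ ∑ n (λ i → f i * c)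
  *-distribʳ-∑ n c f = trans (*-comm _ c) (trans (*-distribˡ-∑ n c f) (∑-cong n (λ i → *-comm c (f i))))

  neg-distrib-∑ : ∀ n (f : Fin n → F) → - ∑ n f ≡ ∑ n (λ i → - f i)
  neg-distrib-∑ ℕ.zero    f = -0#≈0#
  neg-distrib-∑ (ℕ.suc n) f = trans (neg-distrib-+ (f zero) _) (cong (- f zero +_) (neg-distrib-∑ n (λ i → f (suc i))))

  ∑-comm : ∀ m n (f : Fin m → Fin n → F) → ∑ m (λ i → ∑ n (f i)) ≡ ∑ n (λ j → ∑ m (λ i → f i j))
  ∑-comm ℕ.zero    n f = sym (∑-zero n)
  ∑-comm (ℕ.suc m) n f =
    trans (cong (∑ n (f zero) +_) (∑-comm m n (λ i → f (suc i)))) (sym (∑-distrib-+ n (f zero) _))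

  ∑-remove : ∀ n (e : Fin (ℕ.suc n)) (f : Fin (ℕ.suc n) → F) → ∑ (ℕ.suc n) f ≡ f e + ∑ n (removeAt f e)
  ∑-remove n       zero    f = refl
  ∑-remove (ℕ.suc n) (suc e) f = trans (cong (f zero +_) (∑-remove n e (λ i → f (suc i))))
    (solve 3 (λ a b c → a ⊕ (b ⊕ c) ⊜ b ⊕ (a ⊕ c)) refl (f zero) (f (suc e)) _)
    where open +-Solver

  ∑-δ : ∀ n (j : Fin n) (g : Fin n → F) → ∑ n (λ k → δ j k * g k) ≡ g j
  ∑-δ (ℕ.suc n) j g = begin
    ∑ (ℕ.suc n) (λ k → δ j k * g k)
      ≡⟨ ∑-remove n j (λ k → δ j k * g k) ⟩
    δ j j * g j + ∑ n (λ i → δ j (punchIn j i) * g (punchIn j i))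
      ≡⟨ cong₂ _+_ (cong (_* g j) (δ-≡ {j} refl)) (∑-cong n (λ i → cong (_* _) (δ-≢ (λ j≡ → punchInᵢ≢i j i (sym j≡))))) ⟩
    1# * g j + ∑ n (λ i → 0# * g (punchIn j i))
      ≡⟨ cong₂ _+_ (*-identityˡ (g j)) (trans (∑-cong n (λ i → zeroˡ _)) (∑-zero n)) ⟩
    g j + 0#
      ≡⟨ +-identityʳ (g j) ⟩
    g j
      ∎
    where
    open ≡-Reasoning
    δ-≡ : ∀ {i k : Fin (ℕ.suc n)} → i ≡ k → δ i k ≡ 1#
    δ-≡ {i} {k} i≡k with i Fin.≟ k
    ... | yes _   = refl
    ... | no  i≢k = ⊥-elim (i≢k i≡k)
    δ-≢ : ∀ {i k : Fin (ℕ.suc n)} → ¬ i ≡ k → δ i k ≡ 0#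
    δ-≢ {i} {k} i≢k with i Fin.≟ k
    ... | yes i≡k = ⊥-elim (i≢k i≡k)
    ... | no  _   = refl

  ‖‖-cong : ∀ {d} {x y : Point d} → x ≗ y → ‖ x ‖ ≡ ‖ y ‖
  ‖‖-cong {d} x≗y = ∑-cong d (λ i → cong₂ _*_ (x≗y i) (x≗y i))

  ‖-‖-cong : ∀ {d} {x x′ y y′ : Point d} → x ≗ x′ → y ≗ y′ → ‖ x -ᵥ y ‖ ≡ ‖ x′ -ᵥ y′ ‖
  ‖-‖-cong x≗x′ y≗y′ = ‖‖-cong (λ i → cong₂ _−_ (x≗x′ i) (y≗y′ i))

  ‖insertAt-‖ : ∀ {n} (z : Point n) (e : Fin (ℕ.suc n)) a (w : Point (ℕ.suc n)) →
    ‖ insertAt z e a -ᵥ w ‖ ≡ (a − w e) * (a − w e) + ‖ z -ᵥ removeAt w e ‖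
  ‖insertAt-‖ {n} z e a w = trans (∑-remove n e (λ i → (insertAt z e a i − w i) * (insertAt z e a i − w i))) (cong₂ _+_
    (cong (λ t → (t − w e) * (t − w e)) (insertAt-lookup z e a))
    (∑-cong n (λ i → cong (λ t → (t − w (punchIn e i)) * (t − w (punchIn e i))) (insertAt-punchIn z e a i))))

  removeAt-≗⇒≗ : ∀ {n} (x y : Point (ℕ.suc n)) e → x e ≡ y e → removeAt x e ≗ removeAt y e → x ≗ y
  removeAt-≗⇒≗ x y e xe≡ye rest k with e Fin.≟ k
  ... | yes refl = xe≡ye
  ... | no  e≢k  = trans (sym (removeAt-punchOut x e≢k)) (trans (rest (punchOut e≢k)) (removeAt-punchOut y e≢k))

module PointSums {q : ℕ} (𝔽 : FiniteField q) where

  open import Data.Empty using (⊥-elim)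
  open import Data.Fin using (Fin; zero; suc)
  open import Data.Fin.Properties using (all?)
  open import Data.Integer using (ℤ; +_; 0ℤ; 1ℤ; _≤_; +≤+) renaming (_+_ to _+ℤ_; _*_ to _*ℤ_)
  import Data.Integer.Properties as ℤ
  open import Data.List using (map)
  import Data.Nat as ℕ
  open import Data.Vec.Functional using (insertAt)
  open import Relation.Binary.Core using (_Preserves_⟶_)
  open import Relation.Binary.PropositionalEquality
  open import Relation.Nullary using (¬_; Dec; yes; no)
  open FieldBasics 𝔽
  open FieldSums 𝔽
  open IntegerSum

  cons-cong : ∀ {d} a {x y : Point d} → x ≗ y → cons a x ≗ cons a y
  cons-cong a x≗y zero    = refl
  cons-cong a x≗y (suc i) = x≗y i

  sumPoints-cons : ∀ d (f : Point (ℕ.suc d) → ℤ) →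
    ∑[ x ← allPoints (ℕ.suc d) ] f x ≡ ∑[ a ← elems ] ∑[ z ← allPoints d ] f (cons a z)
  sumPoints-cons d f = trans (sumOver-concatMap elems (λ a → map (cons a) (allPoints d)) f)
                             (sumOver-cong elems (λ a → sumOver-map (allPoints d) (cons a) f))

  sumPoints-insertAt : ∀ n (e : Fin (ℕ.suc n)) (f : Point (ℕ.suc n) → ℤ) → f Preserves _≗_ ⟶ _≡_ →
    ∑[ x ← allPoints (ℕ.suc n) ] f x ≡ ∑[ z ← allPoints n ] ∑[ a ← elems ] f (insertAt z e a)
  sumPoints-insertAt n zero f f-cong =
    trans (sumPoints-cons n f) (trans (sumOver-comm elems (allPoints n) _)
      (sumOver-cong (allPoints n) (λ z → sumOver-cong elems (λ a → f-cong (λ { zero → refl ; (suc i) → refl })))))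
  sumPoints-insertAt (ℕ.suc n) (suc e) f f-cong = begin
    ∑[ x ← allPoints (ℕ.suc (ℕ.suc n)) ] f x
      ≡⟨ sumPoints-cons (ℕ.suc n) f ⟩
    ∑[ b ← elems ] ∑[ x ← allPoints (ℕ.suc n) ] f (cons b x)
      ≡⟨ sumOver-cong elems (λ b → sumPoints-insertAt n e (λ x → f (cons b x)) (λ x≗y → f-cong (cons-cong b x≗y))) ⟩
    ∑[ b ← elems ] ∑[ z ← allPoints n ] ∑[ a ← elems ] f (cons b (insertAt z e a))
      ≡⟨ sumOver-cong elems (λ b → sumOver-cong (allPoints n) (λ z → sumOver-cong elems (λ a → f-cong (λ { zero → refl ; (suc i) → refl })))) ⟩
    ∑[ b ← elems ] ∑[ z ← allPoints n ] ∑[ a ← elems ] f (insertAt (cons b z) (suc e) a)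
      ≡⟨ sym (sumPoints-cons n (λ z → ∑[ a ← elems ] f (insertAt z (suc e) a))) ⟩
    ∑[ z ← allPoints (ℕ.suc n) ] ∑[ a ← elems ] f (insertAt z (suc e) a)
      ∎
    where open ≡-Reasoning

  sumPoints-const : ∀ d c → ∑[ x ← allPoints d ] c ≡ c *ℤ + (q ℕ.^ d)
  sumPoints-const ℕ.zero    c = trans (ℤ.+-identityʳ c) (sym (ℤ.*-identityʳ c))
  sumPoints-const (ℕ.suc d) c = begin
    ∑[ x ← allPoints (ℕ.suc d) ] c        ≡⟨ sumPoints-cons d (λ _ → c) ⟩
    ∑[ a ← elems ] ∑[ z ← allPoints d ] c ≡⟨ sumOver-cong elems (λ _ → sumPoints-const d c) ⟩
    ∑[ a ← elems ] (c *ℤ + (q ℕ.^ d))     ≡⟨ sum-elems-const _ ⟩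
    c *ℤ + (q ℕ.^ d) *ℤ + q               ≡⟨ ℤ.*-assoc c _ _ ⟩
    c *ℤ (+ (q ℕ.^ d) *ℤ + q)             ≡⟨ cong (c *ℤ_) (trans (ℤ.*-comm (+ (q ℕ.^ d)) (+ q)) (sym (ℤ.pos-* q (q ℕ.^ d)))) ⟩
    c *ℤ + (q ℕ.^ ℕ.suc d)                ∎
    where open ≡-Reasoning

  _≗?_ : ∀ {d} (x y : Point d) → Dec (x ≗ y)
  x ≗? y = all? (λ i → x i ≟ y i)

  ⟦_≗_⟧ : ∀ {d} → Point d → Point d → ℤ
  ⟦_≗_⟧ {ℕ.zero}  x y = 1ℤ
  ⟦_≗_⟧ {ℕ.suc d} x y = ⟦ x zero ≟ y zero ⟧ *ℤ ⟦ (λ i → x (suc i)) ≗ (λ i → y (suc i)) ⟧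

  ⟦≗⟧-≗ : ∀ {d} {x y : Point d} → x ≗ y → ⟦ x ≗ y ⟧ ≡ 1ℤ
  ⟦≗⟧-≗ {ℕ.zero}  x≗y = refl
  ⟦≗⟧-≗ {ℕ.suc d} x≗y = cong₂ _*ℤ_ (⟦≟⟧-≡ (x≗y zero)) (⟦≗⟧-≗ (λ i → x≗y (suc i)))

  ⟦≗⟧-≭ : ∀ {d} {x y : Point d} → ¬ x ≗ y → ⟦ x ≗ y ⟧ ≡ 0ℤ
  ⟦≗⟧-≭ {ℕ.zero}  x≭y = ⊥-elim (x≭y (λ ()))
  ⟦≗⟧-≭ {ℕ.suc d} {x} {y} x≭y with x zero ≟ y zero
  ... | no  _   = refl
  ... | yes x₀≡y₀ = cong (1ℤ *ℤ_) (⟦≗⟧-≭ (λ x′≗y′ → x≭y (λ { zero → x₀≡y₀ ; (suc i) → x′≗y′ i })))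

  ⟦≗⟧-sym : ∀ {d} (x y : Point d) → ⟦ x ≗ y ⟧ ≡ ⟦ y ≗ x ⟧
  ⟦≗⟧-sym x y with x ≗? y
  ... | yes x≗y = trans (⟦≗⟧-≗ x≗y) (sym (⟦≗⟧-≗ (λ i → sym (x≗y i))))
  ... | no  x≭y = trans (⟦≗⟧-≭ x≭y) (sym (⟦≗⟧-≭ (λ y≗x → x≭y (λ i → sym (y≗x i)))))

  0≤⟦≗⟧ : ∀ {d} (x y : Point d) → 0ℤ ≤ ⟦ x ≗ y ⟧
  0≤⟦≗⟧ x y with x ≗? y
  ... | yes x≗y = subst (0ℤ ≤_) (sym (⟦≗⟧-≗ x≗y)) (+≤+ ℕ.z≤n)
  ... | no  x≭y = subst (0ℤ ≤_) (sym (⟦≗⟧-≭ x≭y)) ℤ.≤-refl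

  sumPoints-sift : ∀ d (w : Point d) (g : Point d → ℤ) → g Preserves _≗_ ⟶ _≡_ →
    ∑[ z ← allPoints d ] (⟦ z ≗ w ⟧ *ℤ g z) ≡ g w
  sumPoints-sift ℕ.zero    w g g-cong = trans (ℤ.+-identityʳ _) (trans (ℤ.*-identityˡ _) (g-cong (λ ())))
  sumPoints-sift (ℕ.suc d) w g g-cong = begin
    ∑[ z ← allPoints (ℕ.suc d) ] (⟦ z ≗ w ⟧ *ℤ g z)
      ≡⟨ sumPoints-cons d (λ z → ⟦ z ≗ w ⟧ *ℤ g z) ⟩
    ∑[ a ← elems ] ∑[ z ← allPoints d ] ((⟦ a ≟ w zero ⟧ *ℤ ⟦ z ≗ w′ ⟧) *ℤ g (cons a z))
      ≡⟨ sumOver-cong elems (λ a → trans (sumOver-cong (allPoints d) (λ z → ℤ.*-assoc ⟦ a ≟ w zero ⟧ _ _))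
                                         (sym (*-distribˡ-sumOver (allPoints d) ⟦ a ≟ w zero ⟧ (λ z → ⟦ z ≗ w′ ⟧ *ℤ g (cons a z))))) ⟩
    ∑[ a ← elems ] (⟦ a ≟ w zero ⟧ *ℤ ∑[ z ← allPoints d ] (⟦ z ≗ w′ ⟧ *ℤ g (cons a z)))
      ≡⟨ sumOver-cong elems (λ a → cong (⟦ a ≟ w zero ⟧ *ℤ_) (sumPoints-sift d w′ (λ z → g (cons a z)) (λ z≗z′ → g-cong (cons-cong a z≗z′)))) ⟩
    ∑[ a ← elems ] (⟦ a ≟ w zero ⟧ *ℤ g (cons a w′))
      ≡⟨ sum-sift (w zero) (λ a → g (cons a w′)) ⟩
    g (cons (w zero) w′)
      ≡⟨ g-cong (λ { zero → refl ; (suc i) → refl }) ⟩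
    g w
      ∎
    where
    open ≡-Reasoning
    w′ : Point d
    w′ i = w (suc i)

  sumPoints-∘-≤ : ∀ d (φ ψ : Point d → Point d) → (∀ x → ψ (φ x) ≗ x) → ψ Preserves _≗_ ⟶ _≗_ →
    ∀ (g : Point d → ℤ) → g Preserves _≗_ ⟶ _≡_ → (∀ z → 0ℤ ≤ g z) →
    ∑[ x ← allPoints d ] g (φ x) ≤ ∑[ z ← allPoints d ] g z
  sumPoints-∘-≤ d φ ψ ψφ≗id ψ-cong g g-cong g≥0 = begin
    ∑[ x ← Pts ] g (φ x)
      ≡⟨ sumOver-cong Pts (λ x → sym (sumPoints-sift d (φ x) g g-cong)) ⟩
    ∑[ x ← Pts ] ∑[ z ← Pts ] (⟦ z ≗ φ x ⟧ *ℤ g z)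
      ≡⟨ sumOver-comm Pts Pts _ ⟩
    ∑[ z ← Pts ] ∑[ x ← Pts ] (⟦ z ≗ φ x ⟧ *ℤ g z)
      ≡⟨ sumOver-cong Pts (λ z → sym (*-distribʳ-sumOver Pts (g z) (λ x → ⟦ z ≗ φ x ⟧))) ⟩
    ∑[ z ← Pts ] (∑[ x ← Pts ] ⟦ z ≗ φ x ⟧ *ℤ g z)
      ≤⟨ sumOver-mono-≤ Pts (λ z → *-monoʳ-≤-0≤ (g≥0 z) (atMostOne z)) ⟩
    ∑[ z ← Pts ] (1ℤ *ℤ g z)
      ≡⟨ sumOver-cong Pts (λ z → ℤ.*-identityˡ (g z)) ⟩
    ∑[ z ← Pts ] g z
      ∎
    where
    open ℤ.≤-Reasoning
    Pts = allPoints d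
    ≤⟦≗ψ⟧ : ∀ z x → ⟦ z ≗ φ x ⟧ ≤ ⟦ x ≗ ψ z ⟧
    ≤⟦≗ψ⟧ z x with z ≗? φ x
    ... | yes z≗φx = ℤ.≤-reflexive (trans (⟦≗⟧-≗ z≗φx) (sym (⟦≗⟧-≗ (λ i → trans (sym (ψφ≗id x i)) (sym (ψ-cong z≗φx i))))))
    ... | no  z≭φx = subst (_≤ ⟦ x ≗ ψ z ⟧) (sym (⟦≗⟧-≭ z≭φx)) (0≤⟦≗⟧ x (ψ z))
    atMostOne : ∀ z → ∑[ x ← Pts ] ⟦ z ≗ φ x ⟧ ≤ 1ℤ
    atMostOne z = ℤ.≤-trans (sumOver-mono-≤ Pts (≤⟦≗ψ⟧ z))
      (ℤ.≤-reflexive (trans (sumOver-cong Pts (λ x → sym (ℤ.*-identityʳ _))) (sumPoints-sift d (ψ z) (λ _ → 1ℤ) (λ _ → refl))))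

module Isometry {q : ℕ} (𝔽 : FiniteField q) where

  open import Relation.Binary.Core using (_Preserves_⟶_)
  open import Relation.Binary.PropositionalEquality
  open FieldBasics 𝔽
  open FinSum 𝔽

  IsOrthogonal : ∀ d → Matrix d → Set
  IsOrthogonal d R = ∀ i j → ∑ d (λ k → R k i * R k j) ≡ δ i j

  module _ {d} (R : Matrix d) (v : Point d) where

    rigidMotion : Point d → Point d
    rigidMotion x = (R · x) +ᵥ v

    rigidMotion⁻¹ : Point d → Point d
    rigidMotion⁻¹ z j = ∑ d (λ i → R i j * (z i − v i))

    rigidMotion⁻¹-cong : rigidMotion⁻¹ Preserves _≗_ ⟶ _≗_
    rigidMotion⁻¹-cong z≗z′ j = ∑-cong d (λ i → cong (λ t → R i j * (t − v i)) (z≗z′ i))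

  module _ {d} (R : Matrix d) (R-orthogonal : IsOrthogonal d R) where
    open ≡-Reasoning

    ‖R·‖ : ∀ z → ‖ R · z ‖ ≡ ‖ z ‖
    ‖R·‖ z = begin
      ∑ d (λ i → ∑ d (λ j → R i j * z j) * ∑ d (λ k → R i k * z k))
        ≡⟨ ∑-cong d (λ i → trans (*-distribʳ-∑ d _ (λ j → R i j * z j))
                                 (∑-cong d (λ j → *-distribˡ-∑ d (R i j * z j) (λ k → R i k * z k)))) ⟩
      ∑ d (λ i → ∑ d (λ j → ∑ d (λ k → (R i j * z j) * (R i k * z k))))
        ≡⟨ ∑-comm d d _ ⟩
      ∑ d (λ j → ∑ d (λ i → ∑ d (λ k → (R i j * z j) * (R i k * z k))))
        ≡⟨ ∑-cong d (λ j → ∑-comm d d _) ⟩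
      ∑ d (λ j → ∑ d (λ k → ∑ d (λ i → (R i j * z j) * (R i k * z k))))
        ≡⟨ ∑-cong d (λ j → ∑-cong d (λ k → ∑-cong d (λ i → interchange (R i j) (z j) (R i k) (z k)))) ⟩
      ∑ d (λ j → ∑ d (λ k → ∑ d (λ i → (R i j * R i k) * (z j * z k))))
        ≡⟨ ∑-cong d (λ j → ∑-cong d (λ k → sym (*-distribʳ-∑ d (z j * z k) (λ i → R i j * R i k)))) ⟩
      ∑ d (λ j → ∑ d (λ k → ∑ d (λ i → R i j * R i k) * (z j * z k)))
        ≡⟨ ∑-cong d (λ j → ∑-cong d (λ k → cong (_* (z j * z k)) (R-orthogonal j k))) ⟩
      ∑ d (λ j → ∑ d (λ k → δ j k * (z j * z k)))
        ≡⟨ ∑-cong d (λ j → ∑-δ d j (λ k → z j * z k)) ⟩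
      ∑ d (λ j → z j * z j)
        ∎
      where
      interchange : ∀ a b c e → (a * b) * (c * e) ≡ (a * c) * (b * e)
      interchange = solve 4 (λ a b c e → (a ⊕ b) ⊕ (c ⊕ e) ⊜ (a ⊕ c) ⊕ (b ⊕ e)) refl
        where open *-Solver

    [R·x]−[R·y]≡R·[x−y] : ∀ x y i → (R · x) i − (R · y) i ≡ (R · (x -ᵥ y)) i
    [R·x]−[R·y]≡R·[x−y] x y i = begin
      ∑ d (λ j → R i j * x j) + - ∑ d (λ j → R i j * y j)
        ≡⟨ cong (∑ d (λ j → R i j * x j) +_) (neg-distrib-∑ d _) ⟩
      ∑ d (λ j → R i j * x j) + ∑ d (λ j → - (R i j * y j))
        ≡⟨ sym (∑-distrib-+ d _ _) ⟩
      ∑ d (λ j → R i j * x j + - (R i j * y j))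
        ≡⟨ ∑-cong d (λ j → trans (cong (R i j * x j +_) (-‿distribʳ-* (R i j) (y j))) (sym (distribˡ (R i j) (x j) (- y j)))) ⟩
      ∑ d (λ j → R i j * (x j + - y j))
        ∎

    rigidMotion-‖-‖ : ∀ v x y → ‖ rigidMotion R v x -ᵥ rigidMotion R v y ‖ ≡ ‖ x -ᵥ y ‖
    rigidMotion-‖-‖ v x y = trans (‖‖-cong (λ i → trans ([x+z]−[y+z]≡x−y _ _ (v i)) ([R·x]−[R·y]≡R·[x−y] x y i))) (‖R·‖ (x -ᵥ y))

    rigidMotion⁻¹∘rigidMotion : ∀ v x → rigidMotion⁻¹ R v (rigidMotion R v x) ≗ x
    rigidMotion⁻¹∘rigidMotion v x j = begin
      ∑ d (λ i → R i j * (((R · x) i + v i) − v i))    ≡⟨ ∑-cong d (λ i → cong (R i j *_) ([x+y]−y≡x _ (v i))) ⟩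
      ∑ d (λ i → R i j * ∑ d (λ k → R i k * x k))      ≡⟨ ∑-cong d (λ i → *-distribˡ-∑ d (R i j) _) ⟩
      ∑ d (λ i → ∑ d (λ k → R i j * (R i k * x k)))    ≡⟨ ∑-comm d d _ ⟩
      ∑ d (λ k → ∑ d (λ i → R i j * (R i k * x k)))    ≡⟨ ∑-cong d (λ k → ∑-cong d (λ i → sym (*-assoc (R i j) (R i k) (x k)))) ⟩
      ∑ d (λ k → ∑ d (λ i → (R i j * R i k) * x k))    ≡⟨ ∑-cong d (λ k → sym (*-distribʳ-∑ d (x k) (λ i → R i j * R i k))) ⟩
      ∑ d (λ k → ∑ d (λ i → R i j * R i k) * x k)      ≡⟨ ∑-cong d (λ k → cong (_* x k) (R-orthogonal j k)) ⟩
      ∑ d (λ k → δ j k * x k)                          ≡⟨ ∑-δ d j x ⟩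
      x j                                              ∎

module Correlation {q : ℕ} (𝔽 : FiniteField q) where

  open import Data.Fin using (Fin)
  open import Data.Integer using (ℤ; +_; 0ℤ) renaming (_*_ to _*ℤ_)
  import Data.Integer.Properties as ℤ
  import Data.Nat as ℕ
  open import Data.Vec.Functional using (insertAt; removeAt)
  open import Relation.Binary.PropositionalEquality
  open import Relation.Nullary using (¬_)
  open FieldBasics 𝔽
  open FieldSums 𝔽
  open FinSum 𝔽
  open PointSums 𝔽
  open IntegerSum

  module MeanZero (1+1≢0 : ¬ 1# + 1# ≡ 0#) (v : F → ℤ) (sum-v≡0 : sumOver elems v ≡ 0ℤ) where

    autocorrelation : F → ℤ
    autocorrelation r = ∑[ c ← elems ] (v c *ℤ v (c + r))

    sum-autocorrelation : ∑[ r ← elems ] autocorrelation r ≡ 0ℤ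
    sum-autocorrelation = begin
      ∑[ r ← elems ] ∑[ c ← elems ] (v c *ℤ v (c + r))
        ≡⟨ sumOver-comm elems elems _ ⟩
      ∑[ c ← elems ] ∑[ r ← elems ] (v c *ℤ v (c + r))
        ≡⟨ sumOver-cong elems (λ c → sym (*-distribˡ-sumOver elems (v c) (λ r → v (c + r)))) ⟩
      ∑[ c ← elems ] (v c *ℤ ∑[ r ← elems ] v (c + r))
        ≡⟨ sumOver-cong elems (λ c → cong (v c *ℤ_)
             (trans (sumOver-cong elems (λ r → cong v (+-comm c r))) (trans (sum-translate c v) sum-v≡0))) ⟩
      ∑[ c ← elems ] (v c *ℤ 0ℤ)
        ≡⟨ sumOver-cong elems (λ c → ℤ.*-zeroʳ (v c)) ⟩
      ∑[ c ← elems ] 0ℤ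
        ≡⟨ sumOver-zero elems ⟩
      0ℤ
        ∎
      where open ≡-Reasoning

    sum-shifted-products : ∀ s s′ → ∑[ c ← elems ] (v (s + c) *ℤ v (s′ + c)) ≡ autocorrelation (s′ − s)
    sum-shifted-products s s′ =
      trans (sumOver-cong elems (λ c → cong₂ (λ a b → v a *ℤ v b) (+-comm s c) (sym (shift c))))
            (sum-translate s (λ c → v c *ℤ v (c + (s′ − s))))
      where
      open +-Solver
      shift : ∀ c → (c + s) + (s′ − s) ≡ s′ + c
      shift c = trans (solve 4 (λ a b e f → (a ⊕ b) ⊕ (e ⊕ f) ⊜ (e ⊕ a) ⊕ (b ⊕ f)) refl c s s′ (- s))
                      (trans (cong (_+_ (s′ + c)) (x−x≡0 s)) (+-identityʳ _))

    -- The map b ↦ γ (2b − σ) + κ is a bijection because 2 and γ are invertible.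
    sum-affine : ∀ γ σ κ → ¬ γ ≡ 0# → (f : F → ℤ) → ∑[ b ← elems ] f (γ * ((b + b) − σ) + κ) ≡ sumOver elems f
    sum-affine γ σ κ γ≢0 f = begin
      ∑[ b ← elems ] f (γ * ((b + b) − σ) + κ)
        ≡⟨ sumOver-cong elems (λ b → cong (λ t → f (γ * (t − σ) + κ)) (b+b≡2b b)) ⟩
      ∑[ b ← elems ] f (γ * (((1# + 1#) * b) − σ) + κ)
        ≡⟨ sum-scale (1# + 1#) 1+1≢0 (λ u → f (γ * (u − σ) + κ)) ⟩
      ∑[ u ← elems ] f (γ * (u − σ) + κ)
        ≡⟨ sum-translate (- σ) (λ w → f (γ * w + κ)) ⟩
      ∑[ w ← elems ] f (γ * w + κ)
        ≡⟨ sum-scale γ γ≢0 (λ t → f (t + κ)) ⟩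
      ∑[ t ← elems ] f (t + κ)
        ≡⟨ sum-translate κ f ⟩
      sumOver elems f
        ∎
      where
      open ≡-Reasoning
      b+b≡2b : ∀ b → b + b ≡ (1# + 1#) * b
      b+b≡2b b = sym (trans (distribʳ b 1# 1#) (cong₂ _+_ (*-identityˡ b) (*-identityˡ b)))

    sphereCorrelation : ∀ {m} → Point m → Point m → ℤ
    sphereCorrelation {m} u u′ = ∑[ z ← allPoints m ] ∑[ c ← elems ] (v (‖ z -ᵥ u ‖ + c) *ℤ v (‖ z -ᵥ u′ ‖ + c))

    sphereCorrelation≡ : ∀ {m} (u u′ : Point m) →
      sphereCorrelation u u′ ≡ ∑[ z ← allPoints m ] autocorrelation (‖ z -ᵥ u′ ‖ − ‖ z -ᵥ u ‖)
    sphereCorrelation≡ {m} u u′ = sumOver-cong (allPoints m) (λ z → sum-shifted-products ‖ z -ᵥ u ‖ ‖ z -ᵥ u′ ‖)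

    sphereCorrelation-≗ : ∀ {m} {u u′ : Point m} → u ≗ u′ →
      sphereCorrelation u u′ ≡ ∑[ c ← elems ] (v c *ℤ v c) *ℤ + (q ℕ.^ m)
    sphereCorrelation-≗ {m} {u} {u′} u≗u′ = begin
      sphereCorrelation u u′
        ≡⟨ sphereCorrelation≡ u u′ ⟩
      ∑[ z ← allPoints m ] autocorrelation (‖ z -ᵥ u′ ‖ − ‖ z -ᵥ u ‖)
        ≡⟨ sumOver-cong (allPoints m) (λ z → cong autocorrelation
             (trans (cong (_− ‖ z -ᵥ u ‖) (‖-‖-cong (λ _ → refl) (λ i → sym (u≗u′ i)))) (x−x≡0 _))) ⟩
      ∑[ z ← allPoints m ] autocorrelation 0#
        ≡⟨ sumPoints-const m _ ⟩
      autocorrelation 0# *ℤ + (q ℕ.^ m)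
        ≡⟨ cong (_*ℤ + (q ℕ.^ m)) (sumOver-cong elems (λ c → cong (λ t → v c *ℤ v t) (+-identityʳ c))) ⟩
      ∑[ c ← elems ] (v c *ℤ v c) *ℤ + (q ℕ.^ m)
        ∎
      where open ≡-Reasoning

    -- Along coordinate j the difference of the two squared distances is affine in z j, with slope 2 (u j − u′ j) ≠ 0.
    sphereCorrelation-≢ : ∀ {m} (u u′ : Point m) (j : Fin m) → ¬ u j ≡ u′ j → sphereCorrelation u u′ ≡ 0ℤ
    sphereCorrelation-≢ {ℕ.suc n} u u′ j uj≢u′j = begin
      sphereCorrelation u u′
        ≡⟨ sphereCorrelation≡ u u′ ⟩
      ∑[ z ← allPoints (ℕ.suc n) ] autocorrelation (‖ z -ᵥ u′ ‖ − ‖ z -ᵥ u ‖)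
        ≡⟨ sumPoints-insertAt n j _ (λ z≗z′ → cong autocorrelation
             (cong₂ _−_ (‖-‖-cong {y = u′} z≗z′ (λ _ → refl)) (‖-‖-cong {y = u} z≗z′ (λ _ → refl)))) ⟩
      ∑[ z ← allPoints n ] ∑[ b ← elems ] autocorrelation (‖ insertAt z j b -ᵥ u′ ‖ − ‖ insertAt z j b -ᵥ u ‖)
        ≡⟨ sumOver-cong (allPoints n) (λ z → sumOver-cong elems (λ b → cong autocorrelation (affine z b))) ⟩
      ∑[ z ← allPoints n ] ∑[ b ← elems ] autocorrelation ((u j − u′ j) * ((b + b) − (u′ j + u j)) + κ z)
        ≡⟨ sumOver-cong (allPoints n) (λ z →
             trans (sum-affine (u j − u′ j) (u′ j + u j) (κ z) (λ d≡0 → uj≢u′j (x−y≡0⇒x≡y d≡0)) autocorrelation)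
                   sum-autocorrelation) ⟩
      ∑[ z ← allPoints n ] 0ℤ
        ≡⟨ sumOver-zero (allPoints n) ⟩
      0ℤ
        ∎
      where
      open ≡-Reasoning
      κ : Point n → F
      κ z = ‖ z -ᵥ removeAt u′ j ‖ − ‖ z -ᵥ removeAt u j ‖
      affine : ∀ z b → ‖ insertAt z j b -ᵥ u′ ‖ − ‖ insertAt z j b -ᵥ u ‖ ≡ (u j − u′ j) * ((b + b) − (u′ j + u j)) + κ z
      affine z b = begin
        ‖ insertAt z j b -ᵥ u′ ‖ − ‖ insertAt z j b -ᵥ u ‖
          ≡⟨ cong₂ _−_ (‖insertAt-‖ z j b u′) (‖insertAt-‖ z j b u) ⟩
        ((b − u′ j) * (b − u′ j) + ‖ z -ᵥ removeAt u′ j ‖) − ((b − u j) * (b − u j) + ‖ z -ᵥ removeAt u j ‖)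
          ≡⟨ [x+u]−[y+w]≡[x−y]+[u−w] _ _ _ _ ⟩
        ((b − u′ j) * (b − u′ j) − (b − u j) * (b − u j)) + κ z
          ≡⟨ cong (_+ κ z) ([x−y]²−[x−z]²≡[z−y][2x−[y+z]] b (u′ j) (u j)) ⟩
        (u j − u′ j) * ((b + b) − (u′ j + u j)) + κ z
          ∎

module Energy {q : ℕ} (𝔽 : FiniteField q) where

  open import Data.Bool using (true; false; _∧_)
  open import Data.Bool.ListAction using (any)
  open import Data.Integer using (ℤ; +_; 0ℤ; 1ℤ; _≤_; +≤+)
    renaming (_+_ to _+ℤ_; _*_ to _*ℤ_; _-_ to _-ℤ_)
  import Data.Integer.Properties as ℤ
  open import Data.Integer.Tactic.RingSolver using (solve-∀)
  import Data.Nat as ℕ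
  open import Data.Fin using (Fin)
  open import Data.Fin.Properties using (¬∀⟶∃¬)
  open import Data.Product using (_,_)
  open import Data.Vec.Functional using (insertAt; removeAt)
  open import Relation.Binary.Core using (_Preserves_⟶_)
  open import Relation.Binary.PropositionalEquality
  open import Relation.Nullary using (¬_; yes; no)
  open import Relation.Nullary.Decidable using (⌊_⌋)
  open FieldBasics 𝔽
  open FieldSums 𝔽
  open FinSum 𝔽
  open PointSums 𝔽
  open IntegerSum

  𝟙 : ∀ {d} → PSet d → Point d → ℤ
  𝟙 S x = indicator (S x)

  +card≡sum𝟙 : ∀ {d} (S : PSet d) → + card S ≡ ∑[ x ← allPoints d ] 𝟙 S x
  +card≡sum𝟙 {d} S = length-filter≡sumOver (allPoints d) S

  +cardΔ≡sum : ∀ {d} (A B : PSet d) → + cardΔ A B ≡ ∑[ t ← elems ] indicator (inΔ A B t)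
  +cardΔ≡sum A B = length-filter≡sumOver elems (inΔ A B)

  module DistanceDistribution {d} (A B : PSet d) where

    private
      Pts = allPoints d

    ν : F → ℤ
    ν t = ∑[ x ← Pts ] ∑[ y ← Pts ] (𝟙 A x *ℤ (𝟙 B y *ℤ ⟦ ‖ x -ᵥ y ‖ ≟ t ⟧))

    ∥ν∥₁ ∥ν∥² : ℤ
    ∥ν∥₁ = sumOver elems ν
    ∥ν∥² = ∑[ t ← elems ] (ν t *ℤ ν t)

    sum-weighted-ν : ∀ (g : F → ℤ) → ∑[ t ← elems ] (g t *ℤ ν t) ≡ ∑[ x ← Pts ] ∑[ y ← Pts ] (𝟙 A x *ℤ (𝟙 B y *ℤ g ‖ x -ᵥ y ‖))
    sum-weighted-ν g = begin
      ∑[ t ← elems ] (g t *ℤ ν t)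
        ≡⟨ sumOver-cong elems (λ t → trans (*-distribˡ-sumOver Pts (g t) _) (sumOver-cong Pts (λ x → *-distribˡ-sumOver Pts (g t) _))) ⟩
      ∑[ t ← elems ] ∑[ x ← Pts ] ∑[ y ← Pts ] (g t *ℤ (𝟙 A x *ℤ (𝟙 B y *ℤ ⟦ ‖ x -ᵥ y ‖ ≟ t ⟧)))
        ≡⟨ trans (sumOver-comm elems Pts _) (sumOver-cong Pts (λ x → sumOver-comm elems Pts _)) ⟩
      ∑[ x ← Pts ] ∑[ y ← Pts ] ∑[ t ← elems ] (g t *ℤ (𝟙 A x *ℤ (𝟙 B y *ℤ ⟦ ‖ x -ᵥ y ‖ ≟ t ⟧)))
        ≡⟨ sumOver-cong Pts (λ x → sumOver-cong Pts (λ y → pull x y)) ⟩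
      ∑[ x ← Pts ] ∑[ y ← Pts ] (𝟙 A x *ℤ (𝟙 B y *ℤ g ‖ x -ᵥ y ‖))
        ∎
      where
      open ≡-Reasoning
      rearrange : ∀ g a b e → g *ℤ (a *ℤ (b *ℤ e)) ≡ (a *ℤ b) *ℤ (e *ℤ g)
      rearrange = solve-∀
      pull : ∀ x y → ∑[ t ← elems ] (g t *ℤ (𝟙 A x *ℤ (𝟙 B y *ℤ ⟦ ‖ x -ᵥ y ‖ ≟ t ⟧))) ≡ 𝟙 A x *ℤ (𝟙 B y *ℤ g ‖ x -ᵥ y ‖)
      pull x y = begin
        ∑[ t ← elems ] (g t *ℤ (𝟙 A x *ℤ (𝟙 B y *ℤ ⟦ ‖ x -ᵥ y ‖ ≟ t ⟧)))
          ≡⟨ sumOver-cong elems (λ t → rearrange (g t) (𝟙 A x) (𝟙 B y) _) ⟩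
        ∑[ t ← elems ] ((𝟙 A x *ℤ 𝟙 B y) *ℤ (⟦ ‖ x -ᵥ y ‖ ≟ t ⟧ *ℤ g t))
          ≡⟨ sym (*-distribˡ-sumOver elems (𝟙 A x *ℤ 𝟙 B y) (λ t → ⟦ ‖ x -ᵥ y ‖ ≟ t ⟧ *ℤ g t)) ⟩
        (𝟙 A x *ℤ 𝟙 B y) *ℤ ∑[ t ← elems ] (⟦ ‖ x -ᵥ y ‖ ≟ t ⟧ *ℤ g t)
          ≡⟨ cong ((𝟙 A x *ℤ 𝟙 B y) *ℤ_)
               (trans (sumOver-cong elems (λ t → cong (_*ℤ g t) (⟦≟⟧-sym _ t))) (sum-sift ‖ x -ᵥ y ‖ g)) ⟩
        (𝟙 A x *ℤ 𝟙 B y) *ℤ g ‖ x -ᵥ y ‖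
          ≡⟨ ℤ.*-assoc (𝟙 A x) (𝟙 B y) _ ⟩
        𝟙 A x *ℤ (𝟙 B y *ℤ g ‖ x -ᵥ y ‖)
          ∎

    ∥ν∥₁≡|A||B| : ∥ν∥₁ ≡ + card A *ℤ + card B
    ∥ν∥₁≡|A||B| = begin
      sumOver elems ν
        ≡⟨ sumOver-cong elems (λ t → sym (ℤ.*-identityˡ (ν t))) ⟩
      ∑[ t ← elems ] (1ℤ *ℤ ν t)
        ≡⟨ sum-weighted-ν (λ _ → 1ℤ) ⟩
      ∑[ x ← Pts ] ∑[ y ← Pts ] (𝟙 A x *ℤ (𝟙 B y *ℤ 1ℤ))
        ≡⟨ sumOver-cong Pts (λ x → trans (sumOver-cong Pts (λ y → cong (𝟙 A x *ℤ_) (ℤ.*-identityʳ (𝟙 B y))))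
                                         (sym (*-distribˡ-sumOver Pts (𝟙 A x) (𝟙 B)))) ⟩
      ∑[ x ← Pts ] (𝟙 A x *ℤ sumOver Pts (𝟙 B))
        ≡⟨ sym (*-distribʳ-sumOver Pts _ (𝟙 A)) ⟩
      sumOver Pts (𝟙 A) *ℤ sumOver Pts (𝟙 B)
        ≡⟨ sym (cong₂ _*ℤ_ (+card≡sum𝟙 A) (+card≡sum𝟙 B)) ⟩
      + card A *ℤ + card B
        ∎
      where open ≡-Reasoning

    ν-outside-Δ : ∀ t → inΔ A B t ≡ false → ν t ≡ 0ℤ
    ν-outside-Δ t t∉Δ = any≡false⇒sumOver≡0 Pts _ _ t∉Δ row
      where
      row : ∀ x → (A x ∧ any (λ y → B y ∧ ⌊ ‖ x -ᵥ y ‖ ≟ t ⌋) Pts) ≡ false →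
            ∑[ y ← Pts ] (𝟙 A x *ℤ (𝟙 B y *ℤ ⟦ ‖ x -ᵥ y ‖ ≟ t ⟧)) ≡ 0ℤ
      row x none with A x
      ... | false = sumOver-zero Pts
      ... | true  = any≡false⇒sumOver≡0 Pts _ _ none
                      (λ y y∉ → trans (ℤ.*-identityˡ _) (trans (indicator-∧ (B y) _) (cong indicator y∉)))

    ∥ν∥₁²≤|Δ|∥ν∥² : ∥ν∥₁ *ℤ ∥ν∥₁ ≤ + cardΔ A B *ℤ ∥ν∥²
    ∥ν∥₁²≤|Δ|∥ν∥² = subst₂ _≤_ (cong₂ _*ℤ_ restrict restrict) (cong (_*ℤ ∥ν∥²) count-Δ)
                      (cauchy-schwarz elems (λ t → indicator (inΔ A B t)) ν)
      where
      count-Δ : ∑[ t ← elems ] (indicator (inΔ A B t) *ℤ indicator (inΔ A B t)) ≡ + cardΔ A B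
      count-Δ = trans (sumOver-cong elems (λ t → indicator-idem (inΔ A B t))) (sym (+cardΔ≡sum A B))
      restrict : ∑[ t ← elems ] (indicator (inΔ A B t) *ℤ ν t) ≡ ∥ν∥₁
      restrict = sumOver-cong elems on-support
        where
        on-support : ∀ t → indicator (inΔ A B t) *ℤ ν t ≡ ν t
        on-support t with inΔ A B t in t∈?Δ
        ... | true  = ℤ.*-identityˡ (ν t)
        ... | false = sym (ν-outside-Δ t t∈?Δ)

    ν⁰ : F → ℤ
    ν⁰ t = + q *ℤ ν t -ℤ ∥ν∥₁

    ∥ν⁰∥² ⟨ν⁰,ν⟩ : ℤ
    ∥ν⁰∥²  = ∑[ t ← elems ] (ν⁰ t *ℤ ν⁰ t)
    ⟨ν⁰,ν⟩ = ∑[ t ← elems ] (ν⁰ t *ℤ ν t)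

    sum-ν⁰ : sumOver elems ν⁰ ≡ 0ℤ
    sum-ν⁰ = begin
      ∑[ t ← elems ] (+ q *ℤ ν t -ℤ ∥ν∥₁)
        ≡⟨ sumOver-distrib-- elems _ _ ⟩
      ∑[ t ← elems ] (+ q *ℤ ν t) -ℤ ∑[ t ← elems ] ∥ν∥₁
        ≡⟨ cong₂ _-ℤ_ (sym (*-distribˡ-sumOver elems (+ q) ν)) (sum-elems-const ∥ν∥₁) ⟩
      + q *ℤ ∥ν∥₁ -ℤ ∥ν∥₁ *ℤ + q
        ≡⟨ cong (+ q *ℤ ∥ν∥₁ -ℤ_) (ℤ.*-comm ∥ν∥₁ (+ q)) ⟩
      + q *ℤ ∥ν∥₁ -ℤ + q *ℤ ∥ν∥₁
        ≡⟨ ℤ.+-inverseʳ (+ q *ℤ ∥ν∥₁) ⟩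
      0ℤ
        ∎
      where open ≡-Reasoning

    ⟨ν⁰,ν⟩≡q∥ν∥²-∥ν∥₁² : ⟨ν⁰,ν⟩ ≡ + q *ℤ ∥ν∥² -ℤ ∥ν∥₁ *ℤ ∥ν∥₁
    ⟨ν⁰,ν⟩≡q∥ν∥²-∥ν∥₁² = begin
      ∑[ t ← elems ] ((+ q *ℤ ν t -ℤ ∥ν∥₁) *ℤ ν t)
        ≡⟨ sumOver-cong elems (λ t → expand (+ q) (ν t) ∥ν∥₁) ⟩
      ∑[ t ← elems ] (+ q *ℤ (ν t *ℤ ν t) -ℤ ∥ν∥₁ *ℤ ν t)
        ≡⟨ sumOver-distrib-- elems _ _ ⟩
      ∑[ t ← elems ] (+ q *ℤ (ν t *ℤ ν t)) -ℤ ∑[ t ← elems ] (∥ν∥₁ *ℤ ν t)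
        ≡⟨ sym (cong₂ _-ℤ_ (*-distribˡ-sumOver elems (+ q) _) (*-distribˡ-sumOver elems ∥ν∥₁ ν)) ⟩
      + q *ℤ ∥ν∥² -ℤ ∥ν∥₁ *ℤ ∥ν∥₁
        ∎
      where
      open ≡-Reasoning
      expand : ∀ q n X → (q *ℤ n -ℤ X) *ℤ n ≡ q *ℤ (n *ℤ n) -ℤ X *ℤ n
      expand = solve-∀

    ∥ν⁰∥²≡q⟨ν⁰,ν⟩ : ∥ν⁰∥² ≡ + q *ℤ ⟨ν⁰,ν⟩
    ∥ν⁰∥²≡q⟨ν⁰,ν⟩ = begin
      ∑[ t ← elems ] (ν⁰ t *ℤ (+ q *ℤ ν t -ℤ ∥ν∥₁))
        ≡⟨ sumOver-cong elems (λ t → expand (+ q) (ν t) ∥ν∥₁ (ν⁰ t)) ⟩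
      ∑[ t ← elems ] (+ q *ℤ (ν⁰ t *ℤ ν t) -ℤ ∥ν∥₁ *ℤ ν⁰ t)
        ≡⟨ sumOver-distrib-- elems _ _ ⟩
      ∑[ t ← elems ] (+ q *ℤ (ν⁰ t *ℤ ν t)) -ℤ ∑[ t ← elems ] (∥ν∥₁ *ℤ ν⁰ t)
        ≡⟨ sym (cong₂ _-ℤ_ (*-distribˡ-sumOver elems (+ q) _) (*-distribˡ-sumOver elems ∥ν∥₁ ν⁰)) ⟩
      + q *ℤ ⟨ν⁰,ν⟩ -ℤ ∥ν∥₁ *ℤ sumOver elems ν⁰
        ≡⟨ cong (λ s → + q *ℤ ⟨ν⁰,ν⟩ -ℤ ∥ν∥₁ *ℤ s) sum-ν⁰ ⟩
      + q *ℤ ⟨ν⁰,ν⟩ -ℤ ∥ν∥₁ *ℤ 0ℤ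
        ≡⟨ drop (+ q *ℤ ⟨ν⁰,ν⟩) ∥ν∥₁ ⟩
      + q *ℤ ⟨ν⁰,ν⟩
        ∎
      where
      open ≡-Reasoning
      expand : ∀ q n X c → c *ℤ (q *ℤ n -ℤ X) ≡ q *ℤ (c *ℤ n) -ℤ X *ℤ c
      expand = solve-∀
      drop : ∀ a X → a -ℤ X *ℤ 0ℤ ≡ a
      drop = solve-∀

  module HyperplaneEnergy (1+1≢0 : ¬ 1# + 1# ≡ 0#) (v : F → ℤ) (sum-v≡0 : sumOver elems v ≡ 0ℤ)
    {m} (B : PSet (ℕ.suc m)) (φ : Point (ℕ.suc m) → Point (ℕ.suc m)) (e : Fin (ℕ.suc m))
    (φ-injective-on-B : ∀ {y y′} → B y ≡ true → B y′ ≡ true → φ y ≗ φ y′ → y ≗ y′)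
    (φ[B]⊆hyperplane : ∀ y → B y ≡ true → φ y e ≡ 0#) where

    open Correlation.MeanZero 𝔽 1+1≢0 v sum-v≡0

    private
      Pts = allPoints (ℕ.suc m)

    h : Point (ℕ.suc m) → ℤ
    h z = ∑[ y ← Pts ] (𝟙 B y *ℤ v ‖ z -ᵥ φ y ‖)

    h-cong : h Preserves _≗_ ⟶ _≡_
    h-cong z≗z′ = sumOver-cong Pts (λ y → cong (λ t → 𝟙 B y *ℤ v t) (‖-‖-cong {y = φ y} z≗z′ (λ _ → refl)))

    ŷ : Point (ℕ.suc m) → Point m
    ŷ y = removeAt (φ y) e

    H : Point m → F → ℤ
    H z c = ∑[ y ← Pts ] (𝟙 B y *ℤ v (‖ z -ᵥ ŷ y ‖ + c))

    h-insertAt : ∀ z a → h (insertAt z e a) ≡ H z (a * a)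
    h-insertAt z a = sumOver-cong Pts term
      where
      term : ∀ y → 𝟙 B y *ℤ v ‖ insertAt z e a -ᵥ φ y ‖ ≡ 𝟙 B y *ℤ v (‖ z -ᵥ ŷ y ‖ + a * a)
      term y with B y in y∈B
      ... | false = refl
      ... | true  = cong (λ t → 1ℤ *ℤ v t) (begin
        ‖ insertAt z e a -ᵥ φ y ‖                     ≡⟨ ‖insertAt-‖ z e a (φ y) ⟩
        (a − φ y e) * (a − φ y e) + ‖ z -ᵥ ŷ y ‖      ≡⟨ cong (λ t → (a − t) * (a − t) + ‖ z -ᵥ ŷ y ‖) (φ[B]⊆hyperplane y y∈B) ⟩
        (a − 0#) * (a − 0#) + ‖ z -ᵥ ŷ y ‖            ≡⟨ cong (λ t → t * t + ‖ z -ᵥ ŷ y ‖) (x−0≡x a) ⟩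
        a * a + ‖ z -ᵥ ŷ y ‖                          ≡⟨ +-comm _ _ ⟩
        ‖ z -ᵥ ŷ y ‖ + a * a                          ∎)
        where open ≡-Reasoning

    sum-H² : ∑[ z ← allPoints m ] ∑[ c ← elems ] (H z c *ℤ H z c)
             ≡ ∑[ y ← Pts ] ∑[ y′ ← Pts ] ((𝟙 B y *ℤ 𝟙 B y′) *ℤ sphereCorrelation (ŷ y) (ŷ y′))
    sum-H² = begin
      ∑[ z ← Pm ] ∑[ c ← elems ] (H z c *ℤ H z c)
        ≡⟨ sumOver-cong Pm (λ z → sumOver-cong elems (λ c → sumOver-product Pts Pts _ _)) ⟩
      ∑[ z ← Pm ] ∑[ c ← elems ] ∑[ y ← Pts ] ∑[ y′ ← Pts ] T z c y y′
        ≡⟨ sumOver-cong Pm (λ z → sumOver-comm elems Pts _) ⟩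
      ∑[ z ← Pm ] ∑[ y ← Pts ] ∑[ c ← elems ] ∑[ y′ ← Pts ] T z c y y′
        ≡⟨ sumOver-comm Pm Pts _ ⟩
      ∑[ y ← Pts ] ∑[ z ← Pm ] ∑[ c ← elems ] ∑[ y′ ← Pts ] T z c y y′
        ≡⟨ sumOver-cong Pts (λ y → sumOver-cong Pm (λ z → sumOver-comm elems Pts _)) ⟩
      ∑[ y ← Pts ] ∑[ z ← Pm ] ∑[ y′ ← Pts ] ∑[ c ← elems ] T z c y y′
        ≡⟨ sumOver-cong Pts (λ y → sumOver-comm Pm Pts _) ⟩
      ∑[ y ← Pts ] ∑[ y′ ← Pts ] ∑[ z ← Pm ] ∑[ c ← elems ] T z c y y′
        ≡⟨ sumOver-cong Pts (λ y → sumOver-cong Pts (λ y′ → factor y y′)) ⟩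
      ∑[ y ← Pts ] ∑[ y′ ← Pts ] ((𝟙 B y *ℤ 𝟙 B y′) *ℤ sphereCorrelation (ŷ y) (ŷ y′))
        ∎
      where
      open ≡-Reasoning
      Pm = allPoints m
      T : Point m → F → Point (ℕ.suc m) → Point (ℕ.suc m) → ℤ
      T z c y y′ = (𝟙 B y *ℤ v (‖ z -ᵥ ŷ y ‖ + c)) *ℤ (𝟙 B y′ *ℤ v (‖ z -ᵥ ŷ y′ ‖ + c))
      interchange : ∀ a b c d → (a *ℤ b) *ℤ (c *ℤ d) ≡ (a *ℤ c) *ℤ (b *ℤ d)
      interchange = solve-∀
      factor : ∀ y y′ → ∑[ z ← Pm ] ∑[ c ← elems ] T z c y y′ ≡ (𝟙 B y *ℤ 𝟙 B y′) *ℤ sphereCorrelation (ŷ y) (ŷ y′)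
      factor y y′ = begin
        ∑[ z ← Pm ] ∑[ c ← elems ] T z c y y′
          ≡⟨ sumOver-cong Pm (λ z → sumOver-cong elems (λ c → interchange (𝟙 B y) _ (𝟙 B y′) _)) ⟩
        ∑[ z ← Pm ] ∑[ c ← elems ] ((𝟙 B y *ℤ 𝟙 B y′) *ℤ (v (‖ z -ᵥ ŷ y ‖ + c) *ℤ v (‖ z -ᵥ ŷ y′ ‖ + c)))
          ≡⟨ sumOver-cong Pm (λ z → sym (*-distribˡ-sumOver elems (𝟙 B y *ℤ 𝟙 B y′) _)) ⟩
        ∑[ z ← Pm ] ((𝟙 B y *ℤ 𝟙 B y′) *ℤ ∑[ c ← elems ] (v (‖ z -ᵥ ŷ y ‖ + c) *ℤ v (‖ z -ᵥ ŷ y′ ‖ + c)))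
          ≡⟨ sym (*-distribˡ-sumOver Pm (𝟙 B y *ℤ 𝟙 B y′) _) ⟩
        (𝟙 B y *ℤ 𝟙 B y′) *ℤ sphereCorrelation (ŷ y) (ŷ y′)
          ∎

    ∥v∥²qᵐ : ℤ
    ∥v∥²qᵐ = ∑[ c ← elems ] (v c *ℤ v c) *ℤ + (q ℕ.^ m)

    0≤∥v∥²qᵐ : 0ℤ ≤ ∥v∥²qᵐ
    0≤∥v∥²qᵐ = 0≤i*j (sumOver-nonNeg elems (λ c → 0≤i*i (v c))) (+≤+ ℕ.z≤n)

    sphereCorrelation-on-B : ∀ y y′ → (𝟙 B y *ℤ 𝟙 B y′) *ℤ sphereCorrelation (ŷ y) (ŷ y′) ≤ (𝟙 B y *ℤ 𝟙 B y′) *ℤ (∥v∥²qᵐ *ℤ ⟦ y ≗ y′ ⟧)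
    sphereCorrelation-on-B y y′ with B y in y∈B | B y′ in y′∈B
    ... | false | _     = ℤ.≤-refl
    ... | true  | false = ℤ.≤-refl
    ... | true  | true  with ŷ y ≗? ŷ y′
    ...   | yes ŷy≗ŷy′ = ℤ.≤-reflexive (cong (1ℤ *ℤ_) (trans (sphereCorrelation-≗ ŷy≗ŷy′)
                            (sym (trans (cong (∥v∥²qᵐ *ℤ_) (⟦≗⟧-≗ y≗y′)) (ℤ.*-identityʳ ∥v∥²qᵐ)))))
      where
      y≗y′ : y ≗ y′
      y≗y′ = φ-injective-on-B y∈B y′∈B
        (removeAt-≗⇒≗ (φ y) (φ y′) e (trans (φ[B]⊆hyperplane y y∈B) (sym (φ[B]⊆hyperplane y′ y′∈B))) ŷy≗ŷy′)
    ...   | no  ŷy≭ŷy′ with ¬∀⟶∃¬ m (λ j → ŷ y j ≡ ŷ y′ j) (λ j → ŷ y j ≟ ŷ y′ j) ŷy≭ŷy′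
    ...     | j , differ = subst (_≤ 1ℤ *ℤ (∥v∥²qᵐ *ℤ ⟦ y ≗ y′ ⟧)) (sym (cong (1ℤ *ℤ_) (sphereCorrelation-≢ (ŷ y) (ŷ y′) j differ)))
                             (0≤i*j {1ℤ} (+≤+ ℕ.z≤n) (0≤i*j 0≤∥v∥²qᵐ (0≤⟦≗⟧ y y′)))

    sum-on-diagonal : ∀ y → ∑[ y′ ← Pts ] ((𝟙 B y *ℤ 𝟙 B y′) *ℤ (∥v∥²qᵐ *ℤ ⟦ y ≗ y′ ⟧)) ≤ 𝟙 B y *ℤ ∥v∥²qᵐ
    sum-on-diagonal y = begin
      ∑[ y′ ← Pts ] ((𝟙 B y *ℤ 𝟙 B y′) *ℤ (∥v∥²qᵐ *ℤ ⟦ y ≗ y′ ⟧))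
        ≡⟨ sumOver-cong Pts (λ y′ → rearrange (𝟙 B y) (𝟙 B y′) ∥v∥²qᵐ ⟦ y ≗ y′ ⟧) ⟩
      ∑[ y′ ← Pts ] (𝟙 B y′ *ℤ (⟦ y ≗ y′ ⟧ *ℤ (𝟙 B y *ℤ ∥v∥²qᵐ)))
        ≤⟨ sumOver-mono-≤ Pts (λ y′ →
             *-monoʳ-≤-0≤ (0≤i*j (0≤⟦≗⟧ y y′) (0≤i*j (0≤indicator (B y)) 0≤∥v∥²qᵐ)) (indicator≤1 (B y′))) ⟩
      ∑[ y′ ← Pts ] (1ℤ *ℤ (⟦ y ≗ y′ ⟧ *ℤ (𝟙 B y *ℤ ∥v∥²qᵐ)))
        ≡⟨ sumOver-cong Pts (λ y′ → trans (ℤ.*-identityˡ _) (cong (_*ℤ (𝟙 B y *ℤ ∥v∥²qᵐ)) (⟦≗⟧-sym y y′))) ⟩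
      ∑[ y′ ← Pts ] (⟦ y′ ≗ y ⟧ *ℤ (𝟙 B y *ℤ ∥v∥²qᵐ))
        ≡⟨ sumPoints-sift (ℕ.suc m) y (λ _ → 𝟙 B y *ℤ ∥v∥²qᵐ) (λ _ → refl) ⟩
      𝟙 B y *ℤ ∥v∥²qᵐ
        ∎
      where
      open ℤ.≤-Reasoning
      rearrange : ∀ b b′ C δ → (b *ℤ b′) *ℤ (C *ℤ δ) ≡ b′ *ℤ (δ *ℤ (b *ℤ C))
      rearrange = solve-∀

    sum-h²≤ : ∑[ z ← Pts ] (h z *ℤ h z) ≤ + 2 *ℤ (sumOver Pts (𝟙 B) *ℤ ∥v∥²qᵐ)
    sum-h²≤ = begin
      ∑[ z ← Pts ] (h z *ℤ h z)
        ≡⟨ sumPoints-insertAt m e (λ z → h z *ℤ h z) (λ z≗z′ → cong₂ _*ℤ_ (h-cong z≗z′) (h-cong z≗z′)) ⟩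
      ∑[ z ← Pm ] ∑[ a ← elems ] (h (insertAt z e a) *ℤ h (insertAt z e a))
        ≡⟨ sumOver-cong Pm (λ z → sumOver-cong elems (λ a → cong₂ _*ℤ_ (h-insertAt z a) (h-insertAt z a))) ⟩
      ∑[ z ← Pm ] ∑[ a ← elems ] (H z (a * a) *ℤ H z (a * a))
        ≤⟨ sumOver-mono-≤ Pm (λ z → sum-squares≤ (λ c → H z c *ℤ H z c) (λ c → 0≤i*i (H z c))) ⟩
      ∑[ z ← Pm ] (+ 2 *ℤ ∑[ c ← elems ] (H z c *ℤ H z c))
        ≡⟨ sym (*-distribˡ-sumOver Pm (+ 2) (λ z → ∑[ c ← elems ] (H z c *ℤ H z c))) ⟩
      + 2 *ℤ ∑[ z ← Pm ] ∑[ c ← elems ] (H z c *ℤ H z c)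
        ≡⟨ cong (+ 2 *ℤ_) sum-H² ⟩
      + 2 *ℤ ∑[ y ← Pts ] ∑[ y′ ← Pts ] ((𝟙 B y *ℤ 𝟙 B y′) *ℤ sphereCorrelation (ŷ y) (ŷ y′))
        ≤⟨ *-monoˡ-≤-0≤ {k = + 2} (+≤+ ℕ.z≤n) (sumOver-mono-≤ Pts (λ y → sumOver-mono-≤ Pts (sphereCorrelation-on-B y))) ⟩
      + 2 *ℤ ∑[ y ← Pts ] ∑[ y′ ← Pts ] ((𝟙 B y *ℤ 𝟙 B y′) *ℤ (∥v∥²qᵐ *ℤ ⟦ y ≗ y′ ⟧))
        ≤⟨ *-monoˡ-≤-0≤ {k = + 2} (+≤+ ℕ.z≤n) (sumOver-mono-≤ Pts sum-on-diagonal) ⟩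
      + 2 *ℤ ∑[ y ← Pts ] (𝟙 B y *ℤ ∥v∥²qᵐ)
        ≡⟨ cong (+ 2 *ℤ_) (sym (*-distribʳ-sumOver Pts ∥v∥²qᵐ (𝟙 B))) ⟩
      + 2 *ℤ (sumOver Pts (𝟙 B) *ℤ ∥v∥²qᵐ)
        ∎
      where
      open ℤ.≤-Reasoning
      Pm = allPoints m

  module EnergyBound (1+1≢0 : ¬ 1# + 1# ≡ 0#) {m} (A B : PSet (ℕ.suc m))
    (φ ψ : Point (ℕ.suc m) → Point (ℕ.suc m)) (ψ∘φ≗id : ∀ x → ψ (φ x) ≗ x) (ψ-cong : ψ Preserves _≗_ ⟶ _≗_)
    (φ-‖-‖ : ∀ x y → ‖ φ x -ᵥ φ y ‖ ≡ ‖ x -ᵥ y ‖)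
    (e : Fin (ℕ.suc m)) (φ[B]⊆hyperplane : ∀ y → B y ≡ true → φ y e ≡ 0#) where

    φ-injective : ∀ {y y′} → φ y ≗ φ y′ → y ≗ y′
    φ-injective {y} {y′} φy≗φy′ i = trans (sym (ψ∘φ≗id y i)) (trans (ψ-cong φy≗φy′ i) (ψ∘φ≗id y′ i))

    open DistanceDistribution A B
    open HyperplaneEnergy 1+1≢0 ν⁰ sum-ν⁰ B φ e (λ _ _ → φ-injective) φ[B]⊆hyperplane

    private
      Pts = allPoints (ℕ.suc m)
      qᵈ = q ℕ.^ ℕ.suc m

    ⟨ν⁰,ν⟩≡sum-h∘φ : ⟨ν⁰,ν⟩ ≡ ∑[ x ← Pts ] (𝟙 A x *ℤ h (φ x))
    ⟨ν⁰,ν⟩≡sum-h∘φ = trans (sum-weighted-ν ν⁰) (sumOver-cong Pts (λ x →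
      trans (sym (*-distribˡ-sumOver Pts (𝟙 A x) _))
            (cong (𝟙 A x *ℤ_) (sumOver-cong Pts (λ y → cong (λ t → 𝟙 B y *ℤ ν⁰ t) (sym (φ-‖-‖ x y)))))))

    ⟨ν⁰,ν⟩²≤|A|∑h² : ⟨ν⁰,ν⟩ *ℤ ⟨ν⁰,ν⟩ ≤ sumOver Pts (𝟙 A) *ℤ ∑[ z ← Pts ] (h z *ℤ h z)
    ⟨ν⁰,ν⟩²≤|A|∑h² = begin
      ⟨ν⁰,ν⟩ *ℤ ⟨ν⁰,ν⟩
        ≡⟨ sym (cong₂ _*ℤ_ restrict restrict) ⟩
      ∑[ x ← Pts ] (𝟙 A x *ℤ (𝟙 A x *ℤ h (φ x))) *ℤ ∑[ x ← Pts ] (𝟙 A x *ℤ (𝟙 A x *ℤ h (φ x)))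
        ≤⟨ cauchy-schwarz Pts (𝟙 A) (λ x → 𝟙 A x *ℤ h (φ x)) ⟩
      ∑[ x ← Pts ] (𝟙 A x *ℤ 𝟙 A x) *ℤ ∑[ x ← Pts ] ((𝟙 A x *ℤ h (φ x)) *ℤ (𝟙 A x *ℤ h (φ x)))
        ≡⟨ cong₂ _*ℤ_ (sumOver-cong Pts (λ x → indicator-idem (A x))) (sumOver-cong Pts (λ x → square (A x) (h (φ x)))) ⟩
      sumOver Pts (𝟙 A) *ℤ ∑[ x ← Pts ] (𝟙 A x *ℤ (h (φ x) *ℤ h (φ x)))
        ≤⟨ *-monoˡ-≤-0≤ (sumOver-nonNeg Pts (λ x → 0≤indicator (A x))) drop-A ⟩
      sumOver Pts (𝟙 A) *ℤ ∑[ x ← Pts ] (h (φ x) *ℤ h (φ x))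
        ≤⟨ *-monoˡ-≤-0≤ (sumOver-nonNeg Pts (λ x → 0≤indicator (A x)))
             (sumPoints-∘-≤ (ℕ.suc m) φ ψ ψ∘φ≗id ψ-cong (λ z → h z *ℤ h z)
                            (λ z≗z′ → cong₂ _*ℤ_ (h-cong z≗z′) (h-cong z≗z′)) (λ z → 0≤i*i (h z))) ⟩
      sumOver Pts (𝟙 A) *ℤ ∑[ z ← Pts ] (h z *ℤ h z)
        ∎
      where
      open ℤ.≤-Reasoning
      square : ∀ b k → (indicator b *ℤ k) *ℤ (indicator b *ℤ k) ≡ indicator b *ℤ (k *ℤ k)
      square true  k = trans (cong₂ _*ℤ_ (ℤ.*-identityˡ k) (ℤ.*-identityˡ k)) (sym (ℤ.*-identityˡ _))
      square false k = refl
      restrict : ∑[ x ← Pts ] (𝟙 A x *ℤ (𝟙 A x *ℤ h (φ x))) ≡ ⟨ν⁰,ν⟩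
      restrict = trans (sumOver-cong Pts (λ x → trans (sym (ℤ.*-assoc (𝟙 A x) _ _)) (cong (_*ℤ h (φ x)) (indicator-idem (A x)))))
                       (sym ⟨ν⁰,ν⟩≡sum-h∘φ)
      drop-A : ∑[ x ← Pts ] (𝟙 A x *ℤ (h (φ x) *ℤ h (φ x))) ≤ ∑[ x ← Pts ] (h (φ x) *ℤ h (φ x))
      drop-A = sumOver-mono-≤ Pts (λ x →
        ℤ.≤-trans (*-monoʳ-≤-0≤ (0≤i*i (h (φ x))) (indicator≤1 (A x))) (ℤ.≤-reflexive (ℤ.*-identityˡ _)))

    0≤⟨ν⁰,ν⟩ : 0ℤ ≤ ⟨ν⁰,ν⟩
    0≤⟨ν⁰,ν⟩ = 0≤n*i⇒0≤i q {{ q-nonZero }} (subst (0ℤ ≤_) ∥ν⁰∥²≡q⟨ν⁰,ν⟩ (sumOver-nonNeg elems (λ t → 0≤i*i (ν⁰ t))))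

    0≤∥ν∥₁ : 0ℤ ≤ ∥ν∥₁
    0≤∥ν∥₁ = subst (0ℤ ≤_) (sym ∥ν∥₁≡|A||B|) (0≤i*j {+ card A} {+ card B} (+≤+ ℕ.z≤n) (+≤+ ℕ.z≤n))

    ⟨ν⁰,ν⟩²≤2∥ν∥₁qᵈ⟨ν⁰,ν⟩ : ⟨ν⁰,ν⟩ *ℤ ⟨ν⁰,ν⟩ ≤ (+ 2 *ℤ (∥ν∥₁ *ℤ + qᵈ)) *ℤ ⟨ν⁰,ν⟩
    ⟨ν⁰,ν⟩²≤2∥ν∥₁qᵈ⟨ν⁰,ν⟩ = begin
      ⟨ν⁰,ν⟩ *ℤ ⟨ν⁰,ν⟩
        ≤⟨ ⟨ν⁰,ν⟩²≤|A|∑h² ⟩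
      sumOver Pts (𝟙 A) *ℤ ∑[ z ← Pts ] (h z *ℤ h z)
        ≤⟨ *-monoˡ-≤-0≤ (sumOver-nonNeg Pts (λ x → 0≤indicator (A x))) sum-h²≤ ⟩
      sumOver Pts (𝟙 A) *ℤ (+ 2 *ℤ (sumOver Pts (𝟙 B) *ℤ ∥v∥²qᵐ))
        ≡⟨ cong₂ (λ a b → a *ℤ (+ 2 *ℤ (b *ℤ ∥v∥²qᵐ))) (sym (+card≡sum𝟙 A)) (sym (+card≡sum𝟙 B)) ⟩
      + card A *ℤ (+ 2 *ℤ (+ card B *ℤ (∥ν⁰∥² *ℤ + (q ℕ.^ m))))
        ≡⟨ cong (λ s → + card A *ℤ (+ 2 *ℤ (+ card B *ℤ (s *ℤ + (q ℕ.^ m))))) ∥ν⁰∥²≡q⟨ν⁰,ν⟩ ⟩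
      + card A *ℤ (+ 2 *ℤ (+ card B *ℤ ((+ q *ℤ ⟨ν⁰,ν⟩) *ℤ + (q ℕ.^ m))))
        ≡⟨ regroup (+ card A) (+ card B) (+ q) ⟨ν⁰,ν⟩ (+ (q ℕ.^ m)) ⟩
      (+ 2 *ℤ ((+ card A *ℤ + card B) *ℤ (+ q *ℤ + (q ℕ.^ m)))) *ℤ ⟨ν⁰,ν⟩
        ≡⟨ cong₂ (λ X Q → (+ 2 *ℤ (X *ℤ Q)) *ℤ ⟨ν⁰,ν⟩) (sym ∥ν∥₁≡|A||B|) (sym (ℤ.pos-* q (q ℕ.^ m))) ⟩
      (+ 2 *ℤ (∥ν∥₁ *ℤ + qᵈ)) *ℤ ⟨ν⁰,ν⟩
        ∎
      where
      open ℤ.≤-Reasoning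
      regroup : ∀ a b q′ w t → a *ℤ (+ 2 *ℤ (b *ℤ ((q′ *ℤ w) *ℤ t))) ≡ (+ 2 *ℤ ((a *ℤ b) *ℤ (q′ *ℤ t))) *ℤ w
      regroup = solve-∀

    ⟨ν⁰,ν⟩≤2∥ν∥₁qᵈ : ⟨ν⁰,ν⟩ ≤ + 2 *ℤ (∥ν∥₁ *ℤ + qᵈ)
    ⟨ν⁰,ν⟩≤2∥ν∥₁qᵈ = i*i≤j*i⇒i≤j 0≤⟨ν⁰,ν⟩ (0≤i*j {+ 2} (+≤+ ℕ.z≤n) (0≤i*j {j = + qᵈ} 0≤∥ν∥₁ (+≤+ ℕ.z≤n)))
      ⟨ν⁰,ν⟩²≤2∥ν∥₁qᵈ⟨ν⁰,ν⟩

    energy-inequality : + q *ℤ (∥ν∥₁ *ℤ ∥ν∥₁) ≤ + cardΔ A B *ℤ (∥ν∥₁ *ℤ ∥ν∥₁ +ℤ + 2 *ℤ (∥ν∥₁ *ℤ + qᵈ))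
    energy-inequality = begin
      + q *ℤ (∥ν∥₁ *ℤ ∥ν∥₁)
        ≤⟨ *-monoˡ-≤-0≤ {k = + q} (+≤+ ℕ.z≤n) ∥ν∥₁²≤|Δ|∥ν∥² ⟩
      + q *ℤ (+ cardΔ A B *ℤ ∥ν∥²)
        ≡⟨ swap (+ q) (+ cardΔ A B) ∥ν∥² ⟩
      + cardΔ A B *ℤ (+ q *ℤ ∥ν∥²)
        ≡⟨ cong (+ cardΔ A B *ℤ_)
             (trans (split (+ q *ℤ ∥ν∥²) (∥ν∥₁ *ℤ ∥ν∥₁)) (cong (∥ν∥₁ *ℤ ∥ν∥₁ +ℤ_) (sym ⟨ν⁰,ν⟩≡q∥ν∥²-∥ν∥₁²))) ⟩
      + cardΔ A B *ℤ (∥ν∥₁ *ℤ ∥ν∥₁ +ℤ ⟨ν⁰,ν⟩)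
        ≤⟨ *-monoˡ-≤-0≤ {k = + cardΔ A B} (+≤+ ℕ.z≤n) (ℤ.+-monoʳ-≤ (∥ν∥₁ *ℤ ∥ν∥₁) ⟨ν⁰,ν⟩≤2∥ν∥₁qᵈ) ⟩
      + cardΔ A B *ℤ (∥ν∥₁ *ℤ ∥ν∥₁ +ℤ + 2 *ℤ (∥ν∥₁ *ℤ + qᵈ))
        ∎
      where
      open ℤ.≤-Reasoning
      swap : ∀ a b c → a *ℤ (b *ℤ c) ≡ b *ℤ (a *ℤ c)
      swap = solve-∀
      split : ∀ a b → a ≡ b +ℤ (a -ℤ b)
      split = solve-∀

    energy-inequalityℕ : let x = card A ℕ.* card B in
      q ℕ.* (x ℕ.* x) ℕ.≤ cardΔ A B ℕ.* (x ℕ.* x ℕ.+ 2 ℕ.* (x ℕ.* qᵈ))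
    energy-inequalityℕ = ℤ.drop‿+≤+ (subst₂ _≤_ lhs rhs energy-inequality)
      where
      x = card A ℕ.* card B
      ∥ν∥₁≡+x : ∥ν∥₁ ≡ + x
      ∥ν∥₁≡+x = trans ∥ν∥₁≡|A||B| (sym (ℤ.pos-* (card A) (card B)))
      +x*+x : ∥ν∥₁ *ℤ ∥ν∥₁ ≡ + (x ℕ.* x)
      +x*+x = trans (cong₂ _*ℤ_ ∥ν∥₁≡+x ∥ν∥₁≡+x) (sym (ℤ.pos-* x x))
      lhs : + q *ℤ (∥ν∥₁ *ℤ ∥ν∥₁) ≡ + (q ℕ.* (x ℕ.* x))
      lhs = trans (cong (+ q *ℤ_) +x*+x) (sym (ℤ.pos-* q _))
      rhs : + cardΔ A B *ℤ (∥ν∥₁ *ℤ ∥ν∥₁ +ℤ + 2 *ℤ (∥ν∥₁ *ℤ + qᵈ)) ≡ + (cardΔ A B ℕ.* (x ℕ.* x ℕ.+ 2 ℕ.* (x ℕ.* qᵈ)))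
      rhs = begin
        + cardΔ A B *ℤ (∥ν∥₁ *ℤ ∥ν∥₁ +ℤ + 2 *ℤ (∥ν∥₁ *ℤ + qᵈ))
          ≡⟨ cong₂ (λ s t → + cardΔ A B *ℤ (s +ℤ + 2 *ℤ (t *ℤ + qᵈ))) +x*+x ∥ν∥₁≡+x ⟩
        + cardΔ A B *ℤ (+ (x ℕ.* x) +ℤ + 2 *ℤ (+ x *ℤ + qᵈ))
          ≡⟨ cong (λ s → + cardΔ A B *ℤ (+ (x ℕ.* x) +ℤ + 2 *ℤ s)) (sym (ℤ.pos-* x qᵈ)) ⟩
        + cardΔ A B *ℤ (+ (x ℕ.* x) +ℤ + 2 *ℤ + (x ℕ.* qᵈ))
          ≡⟨ cong (λ s → + cardΔ A B *ℤ (+ (x ℕ.* x) +ℤ s)) (sym (ℤ.pos-* 2 (x ℕ.* qᵈ))) ⟩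
        + cardΔ A B *ℤ (+ (x ℕ.* x) +ℤ + (2 ℕ.* (x ℕ.* qᵈ)))
          ≡⟨ cong (+ cardΔ A B *ℤ_) (sym (ℤ.pos-+ (x ℕ.* x) _)) ⟩
        + cardΔ A B *ℤ + (x ℕ.* x ℕ.+ 2 ℕ.* (x ℕ.* qᵈ))
          ≡⟨ sym (ℤ.pos-* (cardΔ A B) _) ⟩
        + (cardΔ A B ℕ.* (x ℕ.* x ℕ.+ 2 ℕ.* (x ℕ.* qᵈ)))
          ∎
        where open ≡-Reasoning

module Arithmetic where

  import Data.Integer as ℤ
  import Data.Integer.Properties as ℤₚ
  open import Data.Nat hiding (_⊓_)
  open import Data.Nat.Properties
  open import Data.Nat.Tactic.RingSolver using (solve-∀)
  open import Data.Rational using (½; _⊓_; toℚᵘ) renaming (_*_ to _*ℚ_; _≤_ to _≤ℚ_)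
  import Data.Rational.Properties as ℚ
  open import Data.Rational.Unnormalised using (mkℚᵘ; *≤*) renaming (_*_ to _*ᵘ_; _≤_ to _≤ᵘ_)
  import Data.Rational.Unnormalised.Properties as ℚᵘ
  open import Data.Sum using (_⊎_; inj₁; inj₂)
  open import Relation.Binary.PropositionalEquality
  open import Relation.Nullary using (yes; no)

  -- Either x ≥ 2qt, and then q x² ≤ 2 k x², or x < 2qt, and then q x² ≤ 4 k q t x.
  energy-dichotomy : ∀ q t x k → .{{NonZero q}} → q * (x * x) ≤ k * (x * x + 2 * (x * (q * t))) →
    q ≤ 2 * k ⊎ x ≤ 2 * k * (2 * t)
  energy-dichotomy q t zero      k _ = inj₂ z≤n
  energy-dichotomy q t x@(suc _) k ineq with 2 * (q * t) ≤? x
  ... | yes 2qt≤x = inj₁ (*-cancelʳ-≤ q (2 * k) (x * x) (begin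
    q * (x * x)                          ≤⟨ ineq ⟩
    k * (x * x + 2 * (x * (q * t)))      ≡⟨ cong (k *_) (cong (x * x +_) (rearrange x (q * t))) ⟩
    k * (x * x + x * (2 * (q * t)))      ≤⟨ *-monoʳ-≤ k (+-monoʳ-≤ (x * x) (*-monoʳ-≤ x 2qt≤x)) ⟩
    k * (x * x + x * x)                  ≡⟨ double k (x * x) ⟩
    2 * k * (x * x)                      ∎))
    where
    open ≤-Reasoning
    rearrange : ∀ x u → 2 * (x * u) ≡ x * (2 * u)
    rearrange = solve-∀
    double : ∀ k s → k * (s + s) ≡ 2 * k * s
    double = solve-∀
  ... | no  2qt≰x = inj₂ (*-cancelʳ-≤ x (2 * k * (2 * t)) q (*-cancelʳ-≤ (x * q) (2 * k * (2 * t) * q) x (begin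
    x * q * x
      ≡⟨ reassoc x q ⟩
    q * (x * x)
      ≤⟨ ineq ⟩
    k * (x * x + 2 * (x * (q * t)))
      ≤⟨ *-monoʳ-≤ k (+-monoˡ-≤ (2 * (x * (q * t))) (*-monoʳ-≤ x (<⇒≤ (≰⇒> 2qt≰x)))) ⟩
    k * (x * (2 * (q * t)) + 2 * (x * (q * t)))
      ≡⟨ collect k x q t ⟩
    2 * k * (2 * t) * q * x
      ∎)))
    where
    open ≤-Reasoning
    reassoc : ∀ x q → x * q * x ≡ q * (x * x)
    reassoc = solve-∀
    collect : ∀ k x q t → k * (x * (2 * (q * t)) + 2 * (x * (q * t))) ≡ 2 * k * (2 * t) * q * x
    collect = solve-∀

  ½*frac≤ : ∀ a b m → a ≤ 2 * m * suc b → ½ *ℚ frac a (suc b) ≤ℚ toℚ m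
  ½*frac≤ a b m a≤2m[1+b] = ℚ.toℚᵘ-cancel-≤ (begin
    toℚᵘ (½ *ℚ frac a (suc b))
      ≃⟨ ℚ.toℚᵘ-homo-* ½ (frac a (suc b)) ⟩
    toℚᵘ ½ *ᵘ toℚᵘ (frac a (suc b))
      ≃⟨ ℚᵘ.*-congˡ {toℚᵘ ½} (ℚ.toℚᵘ-fromℚᵘ (mkℚᵘ (ℤ.+ a) b)) ⟩
    toℚᵘ ½ *ᵘ mkℚᵘ (ℤ.+ a) b
      ≤⟨ *≤* (subst₂ ℤ._≤_ (sym lhs) (ℤₚ.pos-* m (2 * suc b)) (ℤ.+≤+ (≤-trans a≤2m[1+b] (≤-reflexive (swap m b))))) ⟩
    mkℚᵘ (ℤ.+ m) 0
      ≃⟨ ℚᵘ.≃-sym (ℚ.toℚᵘ-fromℚᵘ (mkℚᵘ (ℤ.+ m) 0)) ⟩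
    toℚᵘ (toℚ m)
      ∎)
    where
    open ℚᵘ.≤-Reasoning
    lhs : ℤ._*_ (ℤ._*_ (ℤ.+ 1) (ℤ.+ a)) (ℤ.+ 1) ≡ ℤ.+ a
    lhs = trans (ℤₚ.*-identityʳ _) (ℤₚ.*-identityˡ (ℤ.+ a))
    swap : ∀ m b → 2 * m * suc b ≡ m * (2 * suc b)
    swap = solve-∀

  half-min≤ : ∀ q x t m → .{{NonZero t}} → q ≤ 2 * m ⊎ x ≤ 2 * m * (2 * t) → ½ *ℚ (toℚ q ⊓ frac x (2 * t)) ≤ℚ toℚ m
  half-min≤ q x t@(suc t′) m (inj₁ q≤2m) =
    ℚ.≤-trans (ℚ.*-monoˡ-≤-nonNeg ½ (ℚ.p⊓q≤p (toℚ q) _)) (½*frac≤ q 0 m (subst (q ≤_) (sym (*-identityʳ (2 * m))) q≤2m))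
  half-min≤ q x t@(suc t′) m (inj₂ x≤2m2t) =
    ℚ.≤-trans (ℚ.*-monoˡ-≤-nonNeg ½ (ℚ.p⊓q≤q (toℚ q) _)) (½*frac≤ x (t′ + suc (t′ + 0)) m x≤2m2t)

open import Data.Nat using (ℕ; suc; _≤_; _<_; _*_; _^_; _∸_; s≤s)
open import Data.Nat.Properties using (m^n≢0)
open import Data.Bool using (true)
open import Data.Fin using (Fin; zero; suc)
open import Data.Fin.Subset using (Subset; _∉_; ∣_∣; inside; outside)
open import Data.Fin.Subset.Properties using (drop-there)
open import Data.Product using (Σ; ∃; _×_; _,_; proj₁; proj₂)
open import Data.Rational using (½; _⊓_) renaming (_*_ to _*ℚ_; _≤_ to _≤ℚ_)
open import Data.Vec using (_∷_)
open import Relation.Binary.PropositionalEquality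
open Arithmetic

∣p∣<n⇒∃∉ : ∀ {n} (p : Subset n) → ∣ p ∣ < n → ∃ λ e → e ∉ p
∣p∣<n⇒∃∉ (outside ∷ p) _             = zero , λ ()
∣p∣<n⇒∃∉ (inside  ∷ p) (s≤s ∣p∣<n) with ∣p∣<n⇒∃∉ p ∣p∣<n
... | e , e∉p = suc e , λ e∈ → e∉p (drop-there e∈)

theorem5p1 : (q : ℕ) → OddPrimePower q → (𝔽 : FiniteField q) →
    (d k : ℕ) → 2 ≤ d → 1 ≤ k → k ≤ d ∸ 1 →
    (A B : FF.PSet 𝔽 d) →
    Σ (FF.Point 𝔽 d) (λ x → A x ≡ true) →
    Σ (FF.Point 𝔽 d) (λ y → B y ≡ true) →
    Σ (FF.Point 𝔽 d → Set) (λ S → FF.IsCoordinatablePlane 𝔽 d k S × (∀ y → B y ≡ true → S y)) →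
    ½ *ℚ (toℚ q ⊓ frac (FF.card 𝔽 A * FF.card 𝔽 B) (2 * q ^ (d ∸ 1)))
      ≤ℚ toℚ (FF.cardΔ 𝔽 A B)
theorem5p1 q q-odd 𝔽 (suc m) k (s≤s _) _ k≤d-1 A B _ _ (S , (R , v , I , R-rotation , ∣I∣≡k , S⊆plane , _) , B⊆S) =
  half-min≤ q (card A * card B) (q ^ m) (cardΔ A B) {{ m^n≢0 q m {{ q-nonZero }} }}
    (energy-dichotomy q (q ^ m) (card A * card B) (cardΔ A B) {{ q-nonZero }} energy-inequalityℕ)
  where
  open FF 𝔽 using (card; cardΔ)
  open FieldSums 𝔽 using (q-nonZero; 1+1≢0)
  open Isometry 𝔽
  R-orthogonal : IsOrthogonal (suc m) R
  R-orthogonal = proj₁ R-rotation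
  missing : ∃ λ e → e ∉ I
  missing = ∣p∣<n⇒∃∉ I (subst (_< suc m) (sym ∣I∣≡k) (s≤s k≤d-1))
  e : Fin (suc m)
  e = proj₁ missing
  open Energy.EnergyBound 𝔽 (1+1≢0 q-odd) A B (rigidMotion R v) (rigidMotion⁻¹ R v)
    (rigidMotion⁻¹∘rigidMotion R R-orthogonal v) (rigidMotion⁻¹-cong R v) (rigidMotion-‖-‖ R R-orthogonal v)
    e (λ y y∈B → S⊆plane y (B⊆S y y∈B) e (proj₂ missing))
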